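{- Let $e\geq 2$ and $l\geq 1$. The map $$\tau^l_e:\{(\boldsymbol{\lambda},\mathbf{s}) : \mathbf{s}\in\overline{\mathcal{A}}^l_e,\ \boldsymbol{\lambda}\in\mathfrak{C}^l(e,\mathbf{s})\}\to\{(\lambda,s): s\in\mathbb{Z},\ \lambda \text{ an } e\text{ -core}\},\qquad (\boldsymbol{\lambda},\mathbf{s})\mapsto\Big(\tau_{e,\mathbf{s}}(\boldsymbol{\lambda}),\sum_{i=1}^l s_i\Big)$$ is well defined and bijective.
   Context: A partition is a nonincreasing sequence $\lambda=(\lambda_1\geq\lambda_2\geq\cdots)$ of nonnegative integers with finitely many nonzero terms; an $l$-partition is an $l$-tuple of partitions. For a partition $\lambda$ and $s\in\mathbb{Z}$, set $L_s(\lambda)=\{\lambda_j-j+s: j\geq1\}\subset\mathbb{Z}$. Every subset $L\subset\mathbb{Z}$ containing all sufficiently negative integers and no sufficiently large integers equals $L_t(\mu)$ for a unique partition $\mu$ and unique $t\in\mathbb{Z}$; $\mu$ is the partition associated with $L$. Define $\overline{\mathcal{A}}^l_e=\{(s_1,\ldots,s_l)\in\mathbb{Z}^l: 0\leq s_j-s_i\leq e\text{ for all }i<j\}$ and $\mathcal{A}^l_e=\{(s_1,\ldots,s_l)\in\mathbb{Z}^l: 0\leq s_j-s_i< e\text{ for all }i<j\}$. An $l$-partition $\boldsymbol{\lambda}=(\lambda^1,\ldots,\lambda^l)$ is a reduced $(e,\mathbf{s})$-core if either $l=1$ and $L_{s_1}(\lambda^1)\subset L_{s_1+e}(\lambda^1)$,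 or $l>1$ and $L_{s_1}(\lambda^1)\subset L_{s_2}(\lambda^2)\subset\cdots\subset L_{s_l}(\lambda^l)\subset L_{s_1+e}(\lambda^1)$. For $\mathbf{s}\in\mathbb{Z}^l$, let $s'_i\in\{0,\ldots,e-1\}$ with $s'_i\equiv s_i \pmod e$, and let $\sigma=\sigma_{\mathbf{s}}$ be the unique permutation of $\{1,\ldots,l\}$ with $s'_{\sigma(1)}\leq\cdots\leq s'_{\sigma(l)}$ and $\sigma(i)<\sigma(i+1)$ whenever $s'_{\sigma(i)}=s'_{\sigma(i+1)}$; set $\widetilde{\mathbf{s}}^{\sigma}=(s'_{\sigma(1)},\ldots,s'_{\sigma(l)})\in\mathcal{A}^l_e$. An $l$-partition $\boldsymbol{\lambda}$ is an $(e,\mathbf{s})$-core if $(\lambda^{\sigma(1)},\ldots,\lambda^{\sigma(l)})$ is a reduced $(e,\widetilde{\mathbf{s}}^{\sigma})$-core; $\mathfrak{C}^l(e,\mathbf{s})$ denotes the set of $(e,\mathbf{s})$-cores. Uglov map: for an $l$-partition $\boldsymbol{\lambda}$ and $\mathbf{s}\in\mathbb{Z}^l$, let $L$ be the set of all integers $(l-c)e+qel+r$ where $c\in\{1,\ldots,l\}$ and $k=qe+r\in L_{s_c}(\lambda^c)$, $q\in\mathbb{Z}$, $r\in\{0,\ldots,e-1\}$; then $\tau_{e,\mathbf{s}}(\boldsymbol{\lambda})$ is the partition associated with $L$. An $e$-core is a partition from which no rim $e$-hook can be removed. -}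

module Defs where

open import Data.Nat as ℕ using (ℕ; zero; suc; _∸_)
open import Data.Integer as ℤ using (ℤ; +_; _%ℕ_)
open import Data.List as List using (List; []; _∷_)
open import Data.List.Relation.Unary.All using (All)
import Data.Vec.Relation.Unary.All as VAll
open import Data.Nat.ListAction using (sum)
open import Data.List.Relation.Unary.Linked using (Linked)
open import Data.Vec as Vec using (Vec; lookup; tabulate)
open import Data.Fin using (Fin; toℕ)
open import Data.Fin.Permutation using (Permutation′; _⟨$⟩ʳ_)
open import Data.Product using (Σ; ∃; ∃-syntax; _×_; _,_)
open import Data.Sum using (_⊎_)
open import Relation.Binary.PropositionalEquality using (_≡_)
open import Relation.Binary.Construct.Closure.ReflexiveTransitive using (Star)
open import Relation.Nullary using (¬_)

-- A partition is represented by the list of its NONZERO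
-- parts, which must be nonincreasing (so each partition has exactly one
-- representation and ≡ on lists is equality of partitions).

Partition : Set
Partition = List ℕ

IsPartition : Partition → Set
IsPartition λ′ = Linked ℕ._≥_ λ′ × All (0 ℕ.<_) λ′

-- part λ i = λ_{i+1}  (0-indexed; equals 0 beyond the length)
part : Partition → ℕ → ℕ
part []       _       = 0
part (x ∷ xs) zero    = x
part (x ∷ xs) (suc i) = part xs i

size : Partition → ℕ
size = sum

-- L_s(λ) = { λ_j - j + s : j ≥ 1 }, as a predicate on ℤ
-- (j = suc i, λ_j = part λ i).

LSet : ℤ → Partition → ℤ → Set
LSet s λ′ k = ∃[ i ] (k ≡ (+ part λ′ i ℤ.- + suc i) ℤ.+ s)

_⊆ℤ_ : (ℤ → Set) → (ℤ → Set) → Set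
A ⊆ℤ B = ∀ k → A k → B k

IsAssociatedPartition : (ℤ → Set) → Partition → Set
IsAssociatedPartition L μ =
  IsPartition μ × ∃[ t ] (∀ k → (LSet t μ k → L k) × (L k → LSet t μ k))

-- e-cores via rim hooks.  Cells are (row , column), 0-indexed;
-- (i , j) ∈ λ iff j < λ_{i+1}.  The skew diagram λ/ν consists of the
-- cells (i , j) with ν_{i+1} ≤ j < λ_{i+1}.

Cell : Set
Cell = ℕ × ℕ

InSkew : Partition → Partition → Cell → Set
InSkew λ′ ν (i , j) = part ν i ℕ.≤ j × j ℕ.< part λ′ i

Adjacent : Cell → Cell → Set
Adjacent (i , j) (i′ , j′) =
  (i′ ≡ suc i × j′ ≡ j) ⊎ (i ≡ suc i′ × j ≡ j′) ⊎
  (i′ ≡ i × j′ ≡ suc j) ⊎ (i ≡ i′ × j ≡ suc j′)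

SkewStep : Partition → Partition → Cell → Cell → Set
SkewStep λ′ ν c d = InSkew λ′ ν c × InSkew λ′ ν d × Adjacent c d

IsRimHook : ℕ → Partition → Partition → Set
IsRimHook e λ′ ν =
  IsPartition ν ×
  (∀ i → part ν i ℕ.≤ part λ′ i) ×
  size λ′ ≡ size ν ℕ.+ e ×
  (∀ c d → InSkew λ′ ν c → InSkew λ′ ν d → Star (SkewStep λ′ ν) c d) ×
  (¬ (∃[ i ] ∃[ j ] (InSkew λ′ ν (i , j) × InSkew λ′ ν (suc i , j) ×
                     InSkew λ′ ν (i , suc j) × InSkew λ′ ν (suc i , suc j))))

IsECore : ℕ → Partition → Set
IsECore e λ′ = ¬ (∃[ ν ] IsRimHook e λ′ ν)

-- Multicharges and l-partitions are vectors of length l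
-- (component i : Fin l is the (toℕ i + 1)-th component).

InAbar : (e : ℕ) {l : ℕ} → Vec ℤ l → Set
InAbar e {l} s = ∀ (i j : Fin l) → toℕ i ℕ.< toℕ j →
  (lookup s i ℤ.≤ lookup s j) × (lookup s j ℤ.≤ lookup s i ℤ.+ + e)

-- reduced (e,s)-core (covers l = 1 as well: the chain is then just
-- L_{s_1}(λ^1) ⊆ L_{s_1+e}(λ^1))
IsReducedCore : (e : ℕ) {l : ℕ} → Vec ℤ l → Vec Partition l → Set
IsReducedCore e {l} s λs =
  (∀ (i j : Fin l) → toℕ j ≡ suc (toℕ i) →
     LSet (lookup s i) (lookup λs i) ⊆ℤ LSet (lookup s j) (lookup λs j)) ×
  (∀ (i j : Fin l) → suc (toℕ i) ≡ l → toℕ j ≡ 0 →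
     LSet (lookup s i) (lookup λs i) ⊆ℤ LSet (lookup s j ℤ.+ + e) (lookup λs j))

-- residue s' ∈ {0,…,e-1} of s mod e (e ≥ 2 in all uses)
residue : ℕ → ℤ → ℕ
residue zero    k = 0
residue (suc m) k = k %ℕ suc m

IsSigma : (e : ℕ) {l : ℕ} → Vec ℤ l → Permutation′ l → Set
IsSigma e {l} s σ = ∀ (i j : Fin l) → toℕ j ≡ suc (toℕ i) →
  (residue e (lookup s (σ ⟨$⟩ʳ i)) ℕ.≤ residue e (lookup s (σ ⟨$⟩ʳ j))) ×
  (residue e (lookup s (σ ⟨$⟩ʳ i)) ≡ residue e (lookup s (σ ⟨$⟩ʳ j)) →
     toℕ (σ ⟨$⟩ʳ i) ℕ.< toℕ (σ ⟨$⟩ʳ j))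

-- λ is an (e,s)-core, i.e. λ ∈ 𝔠^l(e,s)
-- (σ_s is unique, so "for the permutation σ_s" is expressed by ∃ σ).
IsCore : (e : ℕ) {l : ℕ} → Vec ℤ l → Vec Partition l → Set
IsCore e {l} s λs = ∃[ σ ] (IsSigma e s σ ×
  IsReducedCore e (tabulate (λ i → + residue e (lookup s (σ ⟨$⟩ʳ i))))
                  (tabulate (λ i → lookup λs (σ ⟨$⟩ʳ i))))

UglovSet : (e : ℕ) {l : ℕ} → Vec ℤ l → Vec Partition l → ℤ → Set
UglovSet e {l} s λs m = ∃[ i ] ∃[ q ] ∃[ r ] (r ℕ.< e ×
  LSet (lookup s i) (lookup λs i) (q ℤ.* + e ℤ.+ + r) ×
  m ≡ + ((l ∸ suc (toℕ i)) ℕ.* e) ℤ.+ q ℤ.* + (e ℕ.* l) ℤ.+ + r)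

IsUglov : (e : ℕ) {l : ℕ} → Vec ℤ l → Vec Partition l → Partition → Set
IsUglov e s λs μ = IsAssociatedPartition (UglovSet e s λs) μ

sumℤ : {l : ℕ} → Vec ℤ l → ℤ
sumℤ = Vec.foldr _ ℤ._+_ (+ 0)

InDomain : (e : ℕ) {l : ℕ} → Vec ℤ l → Vec Partition l → Set
InDomain e s λs = InAbar e s × VAll.All IsPartition λs × IsCore e s λs

module Submission where

-- A charged partition (t, μ) is encoded by its Maya set L_t(μ) ⊆ ℤ.  Four general facts
-- carry the proof.
--  * A Maya set determines its charge and partition (MayaSets.maya-injective); every
--    decidable set that is "full below, empty above" is a Maya set (PartitionOfSet).
--  * Counting the elements of L_t(μ) in a wide window recovers t (Counting.count-L);
--    hence inclusion of Maya sets forces an inequality of charges, and an inclusion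
--    between Maya sets of equal charge is an equality.
--  * The Uglov set U interleaves the components: position uglovPos i q r = (l-1-i)e + qel + r
--    of U holds the element qe + r of the i-th component.  Counting U block by block
--    shows that its charge is Σ s_i (uglov-charge), and U is closed under k ↦ k - e iff
--    the components form the cyclic chain L_{s_1} ⊆ … ⊆ L_{s_l} ⊆ L_{s_1 + e} (RunnerShift).
--  * A partition is an e-core iff its bead set {μ_j - j} is closed under k ↦ k - e:
--    a rim e-hook would break closedness (RimHookBreaksClosure), and a missing bead
--    yields a removable rim e-hook (GapGivesRimHook).
-- The cyclic chain, the reduced-core condition after sorting by σ_s, and s ∈ Ā^l_e are
-- linked through the permutation-invariant TotalChain condition (ChainConditions,
-- UglovBijection).

module IntegerFacts where

  open import Data.Nat using (suc)
  open import Data.Integer as ℤ using (ℤ; +_; _+_; _-_; _≤_; _<_; ∣_∣; 1ℤ)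
  import Data.Integer.Properties as ℤP
  open import Data.Integer.Tactic.RingSolver
  open import Data.Product
  open import Data.Sum
  open import Relation.Binary.PropositionalEquality
  open import Relation.Nullary

  r-diff : ∀ x y → y ≡ x + (y - x)
  r-diff = solve-∀

  ≤⇒+ℕ : ∀ {x y} → x ≤ y → ∃ λ n → y ≡ x + + n
  ≤⇒+ℕ {x} {y} p = ∣ y - x ∣ , trans (r-diff x y) (cong (λ z → x + z) (sym (ℤP.0≤i⇒+∣i∣≡i (ℤP.i≤j⇒0≤j-i p))))

  +ℕ⇒≤ : ∀ {x y} n → y ≡ x + + n → x ≤ y
  +ℕ⇒≤ {x} n refl = ℤP.i≤i+j x (+ n)

  r-suc : ∀ x n → (1ℤ + x) + n ≡ x + (1ℤ + n)
  r-suc = solve-∀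

  <⇒+suc : ∀ {x y} → x < y → ∃ λ n → y ≡ x + + suc n
  <⇒+suc {x} {y} p with ≤⇒+ℕ (ℤP.i<j⇒suc[i]≤j p)
  ... | n , eq = n , trans eq (r-suc x (+ n))

  +suc⇒< : ∀ {x y} n → y ≡ x + + suc n → x < y
  +suc⇒< {x} n eq = ℤP.suc[i]≤j⇒i<j (+ℕ⇒≤ n (trans eq (sym (r-suc x (+ n)))))

  r-cancel : ∀ x a → a ≡ (x + a) - x
  r-cancel = solve-∀

  +-cancelˡ : ∀ x a b → x + a ≡ x + b → a ≡ b
  +-cancelˡ x a b eq = begin
    a           ≡⟨ r-cancel x a ⟩
    (x + a) - x ≡⟨ cong (_- x) eq ⟩
    (x + b) - x ≡⟨ r-cancel x b ⟨
    b           ∎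
    where open ≡-Reasoning

  ≤⊎> : ∀ (x y : ℤ) → x ≤ y ⊎ y < x
  ≤⊎> x y with x ℤP.≤? y
  ... | yes p = inj₁ p
  ... | no ¬p = inj₂ (ℤP.≰⇒> ¬p)

module MayaSets where

  open import Defs
  open IntegerFacts
  open import Data.Nat as ℕ using (ℕ; zero; suc)
  import Data.Nat.Properties as ℕP
  open import Data.Integer as ℤ using (ℤ; +_; _+_; _-_; -_; _≤_; _<_; 0ℤ; 1ℤ)
  import Data.Integer.Properties as ℤP
  open import Data.Integer.Tactic.RingSolver
  open import Data.List using ([]; _∷_)
  open import Data.List.Relation.Unary.All using ([]; _∷_)
  import Data.List.Relation.Unary.Linked as Lk
  open import Data.List.Relation.Unary.Linked using ([]; _∷_)
  open import Data.Product
  open import Data.Sum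
  open import Data.Empty
  open import Relation.Binary.PropositionalEquality
  open import Relation.Nullary
  open import Relation.Nullary.Decidable using (map′)
  open import Relation.Unary using (Decidable)

  isPartition-tail : ∀ {x μ} → IsPartition (x ∷ μ) → IsPartition μ
  isPartition-tail (lk , _ ∷ al) = Lk.tail lk , al

  isPartition-head>0 : ∀ {x μ} → IsPartition (x ∷ μ) → 0 ℕ.< x
  isPartition-head>0 (_ , p ∷ _) = p

  part-step : ∀ {μ} → IsPartition μ → ∀ i → part μ (suc i) ℕ.≤ part μ i
  part-step {[]} P i = ℕ.z≤n
  part-step {x ∷ []} P zero = ℕ.z≤n
  part-step {x ∷ []} P (suc i) = ℕ.z≤n
  part-step {x ∷ y ∷ μ} (h ∷ lk , al) zero = h
  part-step {x ∷ y ∷ μ} P (suc i) = part-step (isPartition-tail P) i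

  part-antitone : ∀ {μ} → IsPartition μ → ∀ {i j} → i ℕ.≤ j → part μ j ℕ.≤ part μ i
  part-antitone {μ} P {i} {j} i≤j with ℕP.m≤n⇒∃[o]m+o≡n i≤j
  ... | d , refl = go d
    where go : ∀ d → part μ (i ℕ.+ d) ℕ.≤ part μ i
          go zero rewrite ℕP.+-identityʳ i = ℕP.≤-refl
          go (suc d) rewrite ℕP.+-suc i d = ℕP.≤-trans (part-step P (i ℕ.+ d)) (go d)

  r-nil : ∀ s a → s ≡ ((+ 0 - a) + s) + a
  r-nil = solve-∀

  L[]⇒< : ∀ {s k} → LSet s [] k → k < s
  L[]⇒< {s} (i , refl) = +suc⇒< i (r-nil s (+ suc i))

  r-nil2 : ∀ k a → k ≡ (+ 0 - a) + (k + a)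
  r-nil2 = solve-∀

  <⇒L[] : ∀ {s k} → k < s → LSet s [] k
  <⇒L[] {s} {k} p with <⇒+suc p
  ... | n , refl = n , r-nil2 k (+ suc n)

  r-cons : ∀ p a s → (p - (1ℤ + a)) + s ≡ (p - a) + (s - 1ℤ)
  r-cons = solve-∀

  L-cons⇒ : ∀ {s x μ k} → LSet s (x ∷ μ) k → k ≡ (+ x - 1ℤ) + s ⊎ LSet (s - 1ℤ) μ k
  L-cons⇒ (zero , eq) = inj₁ eq
  L-cons⇒ {s} {x} {μ} (suc i , eq) = inj₂ (i , trans eq (r-cons (+ part μ i) (+ suc i) s))

  L-cons⇐ : ∀ {s x μ k} → k ≡ (+ x - 1ℤ) + s ⊎ LSet (s - 1ℤ) μ k → LSet s (x ∷ μ) k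
  L-cons⇐ (inj₁ eq) = zero , eq
  L-cons⇐ {s} {x} {μ} (inj₂ (i , eq)) = suc i , trans eq (sym (r-cons (+ part μ i) (+ suc i) s))

  L-dec : ∀ s μ → Decidable (LSet s μ)
  L-dec s [] k = map′ <⇒L[] L[]⇒< (k ℤP.<? s)
  L-dec s (x ∷ μ) k = map′ L-cons⇐ L-cons⇒ ((k ℤP.≟ (+ x - 1ℤ) + s) ⊎-dec L-dec (s - 1ℤ) μ k)
    where open import Relation.Nullary.Decidable using (_⊎-dec_)

  r-sh1 : ∀ p s z → (p + (s + z)) - z ≡ p + s
  r-sh1 = solve-∀

  L-shift⇒ : ∀ {s μ k} z → LSet (s + z) μ k → LSet s μ (k - z)
  L-shift⇒ {s} {μ} z (i , refl) = i , r-sh1 (+ part μ i - + suc i) s z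

  r-sh2 : ∀ k p s z → k - z ≡ p + s → k ≡ p + (s + z)
  r-sh2 k p s z eq = trans (l k z) (trans (cong (_+ z) eq) (l2 p s z))
    where l : ∀ k z → k ≡ (k - z) + z
          l = solve-∀
          l2 : ∀ p s z → (p + s) + z ≡ p + (s + z)
          l2 = solve-∀

  L-shift⇐ : ∀ {s μ k} z → LSet s μ (k - z) → LSet (s + z) μ k
  L-shift⇐ {s} {μ} {k} z (i , eq) = i , r-sh2 k (+ part μ i - + suc i) s z eq

  L-cong-charge : ∀ {s s′ μ k} → s ≡ s′ → LSet s μ k → LSet s′ μ k
  L-cong-charge refl p = p

  ⊆-shift : ∀ {c d ν ν′} z → LSet c ν ⊆ℤ LSet d ν′ → LSet (c + z) ν ⊆ℤ LSet (d + z) ν′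
  ⊆-shift {c} {d} {ν} {ν′} z inc k p = L-shift⇐ {d} {ν′} z (inc (k - z) (L-shift⇒ {c} {ν} z p))

  r-bd : ∀ p a d s → (p + d) + s ≡ ((p - a) + s) + (a + d)
  r-bd = solve-∀

  L-bound : ∀ {s ν k} → IsPartition ν → LSet s ν k → k < + part ν 0 + s
  L-bound {s} {ν} P (i , refl) with ℕP.m≤n⇒∃[o]m+o≡n (part-antitone P {0} {i} ℕ.z≤n)
  ... | d , eq = +suc⇒< (i ℕ.+ d) (begin
       + part ν 0 + s ≡⟨ cong (λ z → + z + s) (sym eq) ⟩
       + (part ν i ℕ.+ d) + s ≡⟨ cong (_+ s) (ℤP.pos-+ (part ν i) d) ⟩
       (+ part ν i + + d) + s ≡⟨ r-bd (+ part ν i) (+ suc i) (+ d) s ⟩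
       ((+ part ν i - + suc i) + s) + (+ suc i + + d) ≡⟨ cong (λ z → ((+ part ν i - + suc i) + s) + z) (sym (ℤP.pos-+ (suc i) d)) ⟩
       ((+ part ν i - + suc i) + s) + + suc (i ℕ.+ d) ∎)
    where open ≡-Reasoning

  SameSet : (ℤ → Set) → (ℤ → Set) → Set
  SameSet A B = (A ⊆ℤ B) × (B ⊆ℤ A)

  SameSet-sym : ∀ {A B} → SameSet A B → SameSet B A
  SameSet-sym (f , g) = g , f

  topBead : ℕ → ℤ → ℤ
  topBead x t = (+ x - 1ℤ) + t

  head≤ : ∀ {x μ} → IsPartition (x ∷ μ) → part μ 0 ℕ.≤ x
  head≤ P = part-step P 0

  r-top1 : ∀ x t → (x + t) - 1ℤ ≡ (x - 1ℤ) + t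
  r-top1 = solve-∀

  <⇒≤pred : ∀ {k y} → k < y → k ≤ y - 1ℤ
  <⇒≤pred {k} {y} p with <⇒+suc p
  ... | n , refl = +ℕ⇒≤ n (l k (+ n))
    where l : ∀ k n → (k + (1ℤ + n)) - 1ℤ ≡ k + n
          l = solve-∀

  ≤topBead : ∀ {t x μ k} → IsPartition (x ∷ μ) → LSet t (x ∷ μ) k → k ≤ topBead x t
  ≤topBead {t} {x} P p = subst (λ z → _ ≤ z) (r-top1 (+ x) t) (<⇒≤pred (L-bound P p))

  r-top2 : ∀ a t → a + (t - 1ℤ) ≡ (a - 1ℤ) + t
  r-top2 = solve-∀

  tail<topBead : ∀ {t x μ k} → IsPartition (x ∷ μ) → LSet (t - 1ℤ) μ k → k < topBead x t
  tail<topBead {t} {x} {μ} P p = subst (λ z → _ < z) (r-top2 (+ x) t)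
    (ℤP.<-≤-trans (L-bound (isPartition-tail P) p) (ℤP.+-monoˡ-≤ (t - 1ℤ) (ℤ.+≤+ (head≤ P))))

  topBead∈L : ∀ {t x μ} → LSet t (x ∷ μ) (topBead x t)
  topBead∈L = L-cons⇐ (inj₁ refl)

  empty-charge-unique : ∀ {t t′} → SameSet (LSet t []) (LSet t′ []) → t ≡ t′
  empty-charge-unique {t} {t′} (f , g) = ℤP.≤-antisym (h f) (h g)
    where h : ∀ {a b} → LSet a [] ⊆ℤ LSet b [] → a ≤ b
          h {a} {b} f with ≤⊎> a b
          ... | inj₁ p = p
          ... | inj₂ b<a = ⊥-elim (ℤP.<-irrefl refl (L[]⇒< (f b (<⇒L[] b<a))))

  r-pred : ∀ t → t - 1ℤ < t
  r-pred t = +suc⇒< 0 (l t)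
    where l : ∀ t → t ≡ (t - 1ℤ) + 1ℤ
          l = solve-∀

  ≢-of-< : ∀ {a b : ℤ} → a < b → a ≡ b → ⊥
  ≢-of-< p refl = ℤP.<-irrefl refl p

  r-x : ∀ x t t′ → (x - 1ℤ) + t′ ≡ t - 1ℤ → t - 1ℤ ≡ t′ - 1ℤ → x ≡ 0ℤ
  r-x x t t′ e1 e2 = +-cancelˡ t′ x 0ℤ (trans (l1 x t′) (trans (cong (_+ 1ℤ) (trans e1 e2)) (l2 t′)))
    where l1 : ∀ x t′ → t′ + x ≡ ((x - 1ℤ) + t′) + 1ℤ
          l1 = solve-∀
          l2 : ∀ t′ → (t′ - 1ℤ) + 1ℤ ≡ t′ + 0ℤ
          l2 = solve-∀

  empty≢nonempty : ∀ t t′ x μ → IsPartition (x ∷ μ) → SameSet (LSet t []) (LSet t′ (x ∷ μ)) → ⊥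
  empty≢nonempty t t′ x μ P (f , g) = go μ P refl
    where
    m′ = topBead x t′
    m′<t : m′ < t
    m′<t = L[]⇒< (g m′ topBead∈L)
    t-1≤m′ : t - 1ℤ ≤ m′
    t-1≤m′ = ≤topBead P (f (t - 1ℤ) (<⇒L[] (r-pred t)))
    m′≡ : m′ ≡ t - 1ℤ
    m′≡ = ℤP.≤-antisym (<⇒≤pred m′<t) t-1≤m′
    S : SameSet (LSet (t - 1ℤ) []) (LSet (t′ - 1ℤ) μ)
    S = (λ k p → [ (λ eq → ⊥-elim (≢-of-< (L[]⇒< p) (trans eq m′≡))) , (λ q → q) ]′
                    (L-cons⇒ (f k (<⇒L[] (ℤP.<-trans (L[]⇒< p) (r-pred t))))))
      , (λ k q → <⇒L[] (subst (λ z → k < z) m′≡ (tail<topBead P q)))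
    go : ∀ ν → IsPartition (x ∷ ν) → ν ≡ μ → ⊥
    go [] P′ refl = ℕP.<-irrefl (sym (ℤP.+-injective (r-x (+ x) t t′ m′≡ (empty-charge-unique S)))) (isPartition-head>0 P)
    go (y ∷ ν) P′ refl = empty≢nonempty (t - 1ℤ) (t′ - 1ℤ) y ν (isPartition-tail P′) S

  r-pm : ∀ t → (t - 1ℤ) + 1ℤ ≡ t
  r-pm = solve-∀

  pred-injective : ∀ {t t′} → t - 1ℤ ≡ t′ - 1ℤ → t ≡ t′
  pred-injective {t} {t′} eq = trans (sym (r-pm t)) (trans (cong (_+ 1ℤ) eq) (r-pm t′))

  topBead-unique : ∀ {t t′ x x′ μ μ′} → IsPartition (x ∷ μ) → IsPartition (x′ ∷ μ′) →
    SameSet (LSet t (x ∷ μ)) (LSet t′ (x′ ∷ μ′)) → topBead x t ≡ topBead x′ t′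
  topBead-unique P P′ (f , g) = ℤP.≤-antisym (≤topBead P′ (f _ topBead∈L)) (≤topBead P (g _ topBead∈L))

  drop-topBead : ∀ {t t′ x x′ μ μ′} → IsPartition (x ∷ μ) → IsPartition (x′ ∷ μ′) →
    SameSet (LSet t (x ∷ μ)) (LSet t′ (x′ ∷ μ′)) → SameSet (LSet (t - 1ℤ) μ) (LSet (t′ - 1ℤ) μ′)
  drop-topBead P P′ S@(f , g) =
      (λ k p → [ (λ eq → ⊥-elim (≢-of-< (tail<topBead P p) (trans eq (sym top≡)))) , (λ q → q) ]′
                 (L-cons⇒ (f k (L-cons⇐ (inj₂ p)))))
    , (λ k p → [ (λ eq → ⊥-elim (≢-of-< (tail<topBead P′ p) (trans eq top≡))) , (λ q → q) ]′
                 (L-cons⇒ (g k (L-cons⇐ (inj₂ p)))))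
    where top≡ = topBead-unique P P′ S

  r-top3 : ∀ a t → (a - 1ℤ) + t ≡ (t - 1ℤ) + a
  r-top3 = solve-∀

  topBead-injective : ∀ {x x′ t} → topBead x t ≡ topBead x′ t → x ≡ x′
  topBead-injective {x} {x′} {t} eq = ℤP.+-injective
    (+-cancelˡ (t - 1ℤ) (+ x) (+ x′) (trans (sym (r-top3 (+ x) t)) (trans eq (r-top3 (+ x′) t))))

  -- A Maya set determines its charge and its partition: strip the top beads one at a time.
  maya-injective : ∀ t t′ μ μ′ → IsPartition μ → IsPartition μ′ → SameSet (LSet t μ) (LSet t′ μ′) → t ≡ t′ × μ ≡ μ′
  maya-injective t t′ [] [] P P′ S = empty-charge-unique S , refl
  maya-injective t t′ [] (x ∷ μ′) P P′ S = ⊥-elim (empty≢nonempty t t′ x μ′ P′ S)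
  maya-injective t t′ (x ∷ μ) [] P P′ S = ⊥-elim (empty≢nonempty t′ t x μ P (SameSet-sym S))
  maya-injective t t′ (x ∷ μ) (x′ ∷ μ′) P P′ S
    with maya-injective (t - 1ℤ) (t′ - 1ℤ) μ μ′ (isPartition-tail P) (isPartition-tail P′) (drop-topBead P P′ S)
  ... | t-1≡t′-1 , refl with pred-injective {t} {t′} t-1≡t′-1
  ... | refl = refl , cong (_∷ μ) (topBead-injective (topBead-unique P P′ S))

module PartitionOfSet where

  open import Defs
  open IntegerFacts
  open MayaSets
  open import Data.Nat as ℕ using (ℕ; zero; suc)
  import Data.Nat.Properties as ℕP
  open import Data.Integer as ℤ using (ℤ; +_; _+_; _-_; -_; _≤_; _<_; 1ℤ)
  import Data.Integer.Properties as ℤP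
  open import Data.Integer.Tactic.RingSolver
  open import Data.List using ([]; _∷_; length)
  open import Data.List.Relation.Unary.All using ([]; _∷_)
  open import Data.List.Relation.Unary.Linked using ([]; [-]; _∷_)
  open import Data.Product
  open import Data.Sum
  open import Data.Empty
  open import Function using (_∘_)
  open import Relation.Binary.PropositionalEquality
  open import Relation.Nullary
  open import Relation.Unary using (Decidable)
  open import Relation.Binary.Definitions using (tri<; tri≈; tri>)

  -- Prepend a part, dropping it when it is 0 (which forces the tail to be empty).
  consPos : ℕ → Partition → Partition
  consPos zero μ = []
  consPos (suc x) μ = suc x ∷ μ

  cons-isPartition : ∀ {x ν} → 0 ℕ.< x → part ν 0 ℕ.≤ x → IsPartition ν → IsPartition (x ∷ ν)
  cons-isPartition {x} {[]} p q P = [-] , p ∷ []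
  cons-isPartition {x} {y ∷ ν} p q (lk , al) = q ∷ lk , p ∷ al

  head0⇒[] : ∀ {ν} → IsPartition ν → part ν 0 ℕ.≤ 0 → ν ≡ []
  head0⇒[] {[]} P q = refl
  head0⇒[] {x ∷ ν} P q = ⊥-elim (ℕP.<-irrefl refl (ℕP.<-≤-trans (isPartition-head>0 P) q))

  consPos-isPartition : ∀ {x ν} → part ν 0 ℕ.≤ x → IsPartition ν → IsPartition (consPos x ν)
  consPos-isPartition {zero} q P = [] , []
  consPos-isPartition {suc x} q P = cons-isPartition (ℕ.s≤s ℕ.z≤n) q P

  r-s1 : ∀ A n → A + (1ℤ + n) ≡ (A + n) + 1ℤ
  r-s1 = solve-∀

  <-suc-≤ : ∀ {y k} → y < k → y + 1ℤ ≤ k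
  <-suc-≤ {y} {k} p = subst (λ z → z ≤ k) (ℤP.+-comm 1ℤ y) (ℤP.i<j⇒suc[i]≤j p)

  <-suc : ∀ y → y < y + 1ℤ
  <-suc y = +suc⇒< 0 refl

  ≤-suc-< : ∀ {k y} → k ≤ y → k < y + 1ℤ
  ≤-suc-< {k} {y} p = ℤP.≤-<-trans p (<-suc y)

  lt-suc⇒ : ∀ {k y} → k < y + 1ℤ → k ≡ y ⊎ k < y
  lt-suc⇒ {k} {y} p with ℤP.<-cmp k y
  ... | tri< a _ _ = inj₂ a
  ... | tri≈ _ b _ = inj₁ b
  ... | tri> _ _ c = ⊥-elim (ℤP.<-irrefl refl (ℤP.<-≤-trans p (<-suc-≤ c)))

  lt-suc⇐ : ∀ {k y} → k ≡ y ⊎ k < y → k < y + 1ℤ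
  lt-suc⇐ {k} {y} (inj₁ refl) = <-suc y
  lt-suc⇐ {k} {y} (inj₂ p) = ℤP.<-trans p (<-suc y)

  window-end< : ∀ A n → A + + n < A + + suc n
  window-end< A n = subst (λ z → A + + n < z) (sym (r-s1 A (+ n))) (<-suc (A + + n))

  Truncated : (ℤ → Set) → ℤ → ℕ → ℤ → Set
  Truncated P A n k = k < A ⊎ (A ≤ k × k < A + + n × P k)

  -- The truncation of P to [A, A + n) is a Maya set with charge A + d, where d ≤ n counts
  -- the elements of P in the window and g = n - d bounds the first part.
  record Truncation (P : ℤ → Set) (A : ℤ) (n : ℕ) : Set where
    field
      d g : ℕ
      μ : Partition
      isP : IsPartition μ
      eqn : n ≡ g ℕ.+ d
      hd : part μ 0 ℕ.≤ g
      same : SameSet (LSet (A + + d) μ) (Truncated P A n)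

  r-b1 : ∀ a A d → (a - 1ℤ) + (A + (1ℤ + d)) ≡ A + (a + d)
  r-b1 = solve-∀
  r-b2 : ∀ A d → (A + (1ℤ + d)) - 1ℤ ≡ A + d
  r-b2 = solve-∀

  consPos-L : ∀ A g d μ → IsPartition μ → part μ 0 ℕ.≤ g →
    SameSet (LSet (A + + suc d) (consPos g μ)) (λ k → k ≡ A + + (g ℕ.+ d) ⊎ LSet (A + + d) μ k)
  consPos-L A zero d μ P h with head0⇒[] P h
  ... | refl =
    (λ k p → [ inj₁ , (λ q → inj₂ (<⇒L[] q)) ]′ (lt-suc⇒ (subst (λ z → k < z) (r-s1 A (+ d)) (L[]⇒< p))))
    , λ k q → <⇒L[] (subst (λ z → k < z) (sym (r-s1 A (+ d)))
         (lt-suc⇐ ([ inj₁ , (λ r → inj₂ (L[]⇒< r)) ]′ q)))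
  consPos-L A (suc y) d μ P h =
    (λ k p → [ (λ eq → inj₁ (trans eq (trans (r-b1 (+ suc y) A (+ d)) (cong (λ z → A + z) (sym (ℤP.pos-+ (suc y) d))))))
             , (λ q → inj₂ (L-cong-charge {μ = μ} (r-b2 A (+ d)) q)) ]′ (L-cons⇒ p))
    , λ k q → L-cons⇐ ([ (λ eq → inj₁ (trans eq (sym (trans (r-b1 (+ suc y) A (+ d)) (cong (λ z → A + z) (sym (ℤP.pos-+ (suc y) d)))))))
                       , (λ r → inj₂ (L-cong-charge {μ = μ} (sym (r-b2 A (+ d))) r)) ]′ q)

  truncation : (P : ℤ → Set) → Decidable P → (A : ℤ) → (n : ℕ) → Truncation P A n
  truncation P dec A zero = record
    { d = 0 ; g = 0 ; μ = [] ; isP = [] , [] ; eqn = refl ; hd = ℕ.z≤n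
    ; same = (λ k p → inj₁ (subst (λ z → k < z) (ℤP.+-identityʳ A) (L[]⇒< p)))
           , λ k → [ (λ p → <⇒L[] (subst (λ z → k < z) (sym (ℤP.+-identityʳ A)) p))
                   , (λ { (_ , q , _) → <⇒L[] q }) ]′ }
  truncation P dec A (suc n) with truncation P dec A n | dec (A + + n)
  ... | r | no ¬p = record
    { d = d ; g = suc g ; μ = μ ; isP = isP ; eqn = cong suc eqn ; hd = ℕP.m≤n⇒m≤1+n hd
    ; same = (λ k p → [ inj₁ , (λ { (a , b , c) → inj₂ (a , ℤP.<-trans b (window-end< A n) , c) }) ]′ (proj₁ same k p))
           , λ k → [ (λ p → proj₂ same k (inj₁ p))
                   , (λ { (a , b , c) → proj₂ same k (inj₂ (a , back k b c , c)) }) ]′ }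
    where
    open Truncation r
    back : ∀ k → k < A + + suc n → P k → k < A + + n
    back k b c with lt-suc⇒ {k} {A + + n} (subst (λ z → k < z) (r-s1 A (+ n)) b)
    ... | inj₁ eq = ⊥-elim (¬p (subst P eq c))
    ... | inj₂ q = q
  ... | r | yes p = record
    { d = suc d ; g = g ; μ = consPos g μ ; isP = consPos-isPartition hd isP
    ; eqn = trans (cong suc eqn) (sym (ℕP.+-suc g d)) ; hd = hd0 g
    ; same = (λ k q → [ (λ eq → inj₂ (A≤ k eq , ltn k eq , subst P (sym (trans eq (cong (λ z → A + + z) (sym eqn)))) p))
                      , (λ q → [ inj₁ , (λ { (a , b , c) → inj₂ (a , ℤP.<-trans b (window-end< A n) , c) }) ]′ (proj₁ same k q)) ]′
                      (proj₁ S k q))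
           , λ k w → proj₂ S k (fwd k w) }
    where
    open Truncation r
    S = consPos-L A g d μ isP hd
    hd0 : ∀ g → part (consPos g μ) 0 ℕ.≤ g
    hd0 zero = ℕ.z≤n
    hd0 (suc g) = ℕP.≤-refl
    eqn' : A + + n ≡ A + + (g ℕ.+ d)
    eqn' = cong (λ z → A + + z) eqn
    A≤ : ∀ k → k ≡ A + + (g ℕ.+ d) → A ≤ k
    A≤ k eq = +ℕ⇒≤ (g ℕ.+ d) eq
    ltn : ∀ k → k ≡ A + + (g ℕ.+ d) → k < A + + suc n
    ltn k eq = subst (λ z → k < z) (sym (r-s1 A (+ n))) (lt-suc⇐ (inj₁ (trans eq (sym eqn'))))
    fwd : ∀ k → Truncated P A (suc n) k → k ≡ A + + (g ℕ.+ d) ⊎ LSet (A + + d) μ k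
    fwd k (inj₁ q) = inj₂ (proj₂ same k (inj₁ q))
    fwd k (inj₂ (a , b , c)) with lt-suc⇒ {k} {A + + n} (subst (λ z → k < z) (r-s1 A (+ n)) b)
    ... | inj₁ eq = inj₁ (trans eq eqn')
    ... | inj₂ q = inj₂ (proj₂ same k (inj₂ (a , q , c)))

  record Associated (P : ℤ → Set) : Set where
    field
      t : ℤ
      μ : Partition
      isP : IsPartition μ
      same : SameSet (LSet t μ) P

  associated : (P : ℤ → Set) → Decidable P → (A : ℤ) (n : ℕ) →
          (∀ k → k < A → P k) → (∀ k → A + + n ≤ k → ¬ P k) → Associated P
  associated P dec A n lo hi = record
    { t = A + + d ; μ = μ ; isP = isP
    ; same = (λ k q → [ lo k , (λ { (_ , _ , c) → c }) ]′ (proj₁ same k q))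
           , λ k p → proj₂ same k (fw k p) }
    where
    open Truncation (truncation P dec A n)
    fw : ∀ k → P k → Truncated P A n k
    fw k p with ≤⊎> A k
    ... | inj₂ q = inj₁ q
    ... | inj₁ q with ≤⊎> (A + + n) k
    ...   | inj₁ r = ⊥-elim (hi k r p)
    ...   | inj₂ r = inj₂ (q , r , p)

  partitionOfParts : (ℕ → ℕ) → ℕ → Partition
  partitionOfParts q zero = []
  partitionOfParts q (suc N) = consPos (q 0) (partitionOfParts (q ∘ suc) N)

  Antitone : (ℕ → ℕ) → Set
  Antitone q = ∀ i → q (suc i) ℕ.≤ q i

  antitone-head : ∀ q → Antitone q → ∀ i → q i ℕ.≤ q 0
  antitone-head q h zero = ℕP.≤-refl
  antitone-head q h (suc i) = ℕP.≤-trans (h i) (antitone-head q h i)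

  partitionOfParts-part : ∀ q N → Antitone q → (∀ i → N ℕ.≤ i → q i ≡ 0) → ∀ i → part (partitionOfParts q N) i ≡ q i
  partitionOfParts-part q zero h v i = sym (v i ℕ.z≤n)
  partitionOfParts-part q (suc N) h v i with q 0 in eq
  ... | zero = sym (ℕP.n≤0⇒n≡0 (subst (q i ℕ.≤_) eq (antitone-head q h i)))
  ... | suc y with i
  ...   | zero = sym eq
  ...   | suc i′ = partitionOfParts-part (q ∘ suc) N (λ i → h (suc i)) (λ i le → v (suc i) (ℕ.s≤s le)) i′

  partitionOfParts-length : ∀ q N → length (partitionOfParts q N) ℕ.≤ N
  partitionOfParts-length q zero = ℕ.z≤n
  partitionOfParts-length q (suc N) with q 0
  ... | zero = ℕ.z≤n
  ... | suc y = ℕ.s≤s (partitionOfParts-length (q ∘ suc) N)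

  partitionOfParts-isPartition : ∀ q N → Antitone q → (∀ i → N ℕ.≤ i → q i ≡ 0) → IsPartition (partitionOfParts q N)
  partitionOfParts-isPartition q zero h v = [] , []
  partitionOfParts-isPartition q (suc N) h v with q 0 in eq
  ... | zero = [] , []
  ... | suc y = cons-isPartition (ℕ.s≤s ℕ.z≤n)
          (subst (ℕ._≤ suc y) (sym (partitionOfParts-part (q ∘ suc) N (λ i → h (suc i)) (λ i le → v (suc i) (ℕ.s≤s le)) 0))
            (subst (q 1 ℕ.≤_) eq (h 0)))
          (partitionOfParts-isPartition (q ∘ suc) N (λ i → h (suc i)) (λ i le → v (suc i) (ℕ.s≤s le)))

module Counting where

  open import Defs
  open IntegerFacts
  open MayaSets
  open PartitionOfSet using (r-s1; <-suc; ≤-suc-<; lt-suc⇒; lt-suc⇐; <-suc-≤)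
  open import Data.Nat as ℕ using (ℕ; zero; suc)
  import Data.Nat.Properties as ℕP
  open import Data.Integer as ℤ using (ℤ; +_; -[1+_]; _+_; _-_; -_; _≤_; _<_; ∣_∣; 1ℤ)
  import Data.Integer.Properties as ℤP
  open import Data.Integer.Tactic.RingSolver
  open import Data.List using ([]; _∷_; length)
  open import Data.Product
  open import Data.Sum
  open import Data.Empty
  open import Relation.Binary.PropositionalEquality
  open import Relation.Nullary
  open import Relation.Unary using (Decidable)

  indicator : ∀ {X : Set} → Dec X → ℕ
  indicator (yes _) = 1
  indicator (no _) = 0

  count : ∀ {P : ℤ → Set} → Decidable P → ℤ → ℕ → ℕ
  count dec a zero = 0
  count dec a (suc n) = indicator (dec a) ℕ.+ count dec (a + 1ℤ) n

  r-w1 : ∀ a n → (a + 1ℤ) + n ≡ a + (1ℤ + n)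
  r-w1 = solve-∀

  win-tail : ∀ {a k} n → a + 1ℤ ≤ k → k < (a + 1ℤ) + + n → a ≤ k × k < a + + suc n
  win-tail {a} {k} n p q = ℤP.≤-trans (ℤP.<⇒≤ (<-suc a)) p , subst (λ z → k < z) (r-w1 a (+ n)) q

  win-head : ∀ a n → a ≤ a × a < a + + suc n
  win-head a n = ℤP.≤-refl , +suc⇒< n refl

  indicator-mono : ∀ {X Y : Set} (dx : Dec X) (dy : Dec Y) → (X → Y) → indicator dx ℕ.≤ indicator dy
  indicator-mono (yes x) (yes y) f = ℕP.≤-refl
  indicator-mono (yes x) (no ¬y) f = ⊥-elim (¬y (f x))
  indicator-mono (no ¬x) dy f = ℕ.z≤n

  count-cong : ∀ {P Q : ℤ → Set} (dP : Decidable P) (dQ : Decidable Q) a n →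
    (∀ k → a ≤ k → k < a + + n → (P k → Q k) × (Q k → P k)) → count dP a n ≡ count dQ a n
  count-cong dP dQ a zero h = refl
  count-cong dP dQ a (suc n) h = cong₂ ℕ._+_
    (ℕP.≤-antisym (indicator-mono (dP a) (dQ a) (proj₁ (uncurry (h a) (win-head a n))))
                  (indicator-mono (dQ a) (dP a) (proj₂ (uncurry (h a) (win-head a n)))))
    (count-cong dP dQ (a + 1ℤ) n (λ k p q → uncurry (h k) (win-tail n p q)))

  count-mono : ∀ {P Q : ℤ → Set} (dP : Decidable P) (dQ : Decidable Q) a n →
    (∀ k → P k → Q k) → count dP a n ℕ.≤ count dQ a n
  count-mono dP dQ a zero h = ℕ.z≤n
  count-mono dP dQ a (suc n) h = ℕP.+-mono-≤ (indicator-mono (dP a) (dQ a) (h a)) (count-mono dP dQ (a + 1ℤ) n h)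

  win-shrink : ∀ {a k} n → a ≤ k → a ≢ k → k < a + + suc n → a + 1ℤ ≤ k × k < (a + 1ℤ) + + n
  win-shrink {a} {k} n a≤k a≢k k<end = <-suc-≤ (ℤP.≤∧≢⇒< a≤k a≢k) , subst (λ z → k < z) (sym (r-w1 a (+ n))) k<end

  count-≤⇒⊇ : ∀ {P Q : ℤ → Set} (dP : Decidable P) (dQ : Decidable Q) a n →
    (∀ k → P k → Q k) → count dQ a n ℕ.≤ count dP a n →
    ∀ k → a ≤ k → k < a + + n → Q k → P k
  count-≤⇒⊇ dP dQ a zero P⊆Q le k a≤k k<a qk =
    ⊥-elim (ℤP.<-irrefl refl (ℤP.<-≤-trans k<a (subst (λ z → z ≤ k) (sym (ℤP.+-identityʳ a)) a≤k)))
  count-≤⇒⊇ dP dQ a (suc n) P⊆Q le k a≤k k<end qk with dP a | dQ a | a ℤP.≟ k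
  ... | yes pa | _      | yes refl = pa
  ... | no _   | no ¬qa | yes refl = ⊥-elim (¬qa qk)
  ... | yes pa | no ¬qa | _        = ⊥-elim (¬qa (P⊆Q a pa))
  ... | no _   | yes _  | _        =
    ⊥-elim (ℕP.<-irrefl refl (ℕP.<-≤-trans (ℕ.s≤s (count-mono dP dQ (a + 1ℤ) n P⊆Q)) le))
  ... | yes _  | yes _  | no a≢k   =
    uncurry (count-≤⇒⊇ dP dQ (a + 1ℤ) n P⊆Q (ℕP.+-cancelˡ-≤ 1 _ _ le) k) (win-shrink n a≤k a≢k k<end) qk
  ... | no _   | no _   | no a≢k   =
    uncurry (count-≤⇒⊇ dP dQ (a + 1ℤ) n P⊆Q le k) (win-shrink n a≤k a≢k k<end) qk

  r-w2 : ∀ a m → (a + 1ℤ) + m ≡ a + (1ℤ + m)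
  r-w2 = solve-∀

  count-split : ∀ {P : ℤ → Set} (d : Decidable P) a m n → count d a (m ℕ.+ n) ≡ count d a m ℕ.+ count d (a + + m) n
  count-split d a zero n = cong (λ z → count d z n) (sym (ℤP.+-identityʳ a))
  count-split d a (suc m) n = trans (cong (λ z → indicator (d a) ℕ.+ z) (trans (count-split d (a + 1ℤ) m n)
    (cong (λ z → count d (a + 1ℤ) m ℕ.+ count d z n) (r-w2 a (+ m)))))
    (sym (ℕP.+-assoc (indicator (d a)) _ _))

  count-empty : ∀ {P : ℤ → Set} (d : Decidable P) a n → (∀ k → a ≤ k → k < a + + n → ¬ P k) → count d a n ≡ 0
  count-empty d a zero h = refl
  count-empty d a (suc n) h with d a
  ... | yes pa = ⊥-elim (uncurry (h a) (win-head a n) pa)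
  ... | no _ = count-empty d (a + 1ℤ) n (λ k p q → uncurry (h k) (win-tail n p q))

  count-L[] : ∀ c a j n → c ≡ a + + j → j ℕ.≤ n → count (L-dec c []) a n ≡ j
  count-L[] c a zero zero eq le = refl
  count-L[] c a (suc j) zero eq ()
  count-L[] c a j (suc n) eq le with L-dec c [] a
  count-L[] c a zero (suc n) eq le | yes p = ⊥-elim (ℤP.<-irrefl (sym (trans eq (ℤP.+-identityʳ a))) (L[]⇒< p))
  count-L[] c a zero (suc n) eq le | no _ = count-empty (L-dec c []) (a + 1ℤ) n
    (λ k p q r → ℤP.<-irrefl refl (ℤP.<-≤-trans (L[]⇒< r) (subst (λ z → z ≤ k) (sym (trans eq (ℤP.+-identityʳ a))) (ℤP.<⇒≤ (ℤP.<-≤-trans (<-suc a) p)))))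
  count-L[] c a (suc j) (suc n) eq (ℕ.s≤s le) | yes p = cong suc (count-L[] c (a + 1ℤ) j n (trans eq (sym (r-w2 a (+ j)))) le)
  count-L[] c a (suc j) (suc n) eq le | no ¬p = ⊥-elim (¬p (<⇒L[] (+suc⇒< j eq)))

  count-insert : ∀ {P Q : ℤ → Set} (dP : Decidable P) (dQ : Decidable Q) m a n →
    (∀ k → (Q k → k ≡ m ⊎ P k) × (k ≡ m ⊎ P k → Q k)) → ¬ P m → a ≤ m → m < a + + n →
    count dQ a n ≡ suc (count dP a n)
  count-insert dP dQ m a zero h npm p q = ⊥-elim (ℤP.<-irrefl refl (ℤP.<-≤-trans q (subst (λ z → z ≤ m) (sym (ℤP.+-identityʳ a)) p)))
  count-insert dP dQ m a (suc n) h npm p q with a ℤP.≟ m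
  ... | yes refl with dQ a | dP a
  ...   | yes _ | no _ = cong suc (count-cong dQ dP (a + 1ℤ) n (λ k r s →
            (λ qk → [ (λ eq → ⊥-elim (ℤP.<-irrefl (sym eq) (ℤP.<-≤-trans (<-suc a) r))) , (λ x → x) ]′ (proj₁ (h k) qk))
          , (λ pk → proj₂ (h k) (inj₂ pk))))
  ...   | _ | yes pa = ⊥-elim (npm pa)
  ...   | no nq | no _ = ⊥-elim (nq (proj₂ (h a) (inj₁ refl)))
  count-insert dP dQ m a (suc n) h npm p q | no a≢m with dQ a | dP a
  ... | yes _ | yes _ = cong suc (uncurry (count-insert dP dQ m (a + 1ℤ) n h npm) (win-shrink n p a≢m q))
  ... | no _ | no _ = uncurry (count-insert dP dQ m (a + 1ℤ) n h npm) (win-shrink n p a≢m q)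
  ... | yes qa | no np = ⊥-elim ([ (λ eq → a≢m eq) , np ]′ (proj₁ (h a) qa))
  ... | no nq | yes pa = ⊥-elim (nq (proj₂ (h a) (inj₂ pa)))

  cancelˡ-≤ : ∀ a x y → a + x ≤ a + y → x ≤ y
  cancelˡ-≤ a x y p = subst₂ _≤_ (l a x) (l a y) (ℤP.+-monoʳ-≤ (- a) p)
    where l : ∀ a x → (- a) + (a + x) ≡ x
          l = solve-∀

  Wide : ℤ → ℕ → ℤ → Partition → Set
  Wide a n c ν = (a + + length ν ≤ c) × (c + + part ν 0 ≤ a + + n)

  +suc≤⇒≤pred : ∀ a l c → a + (1ℤ + l) ≤ c → a + l ≤ c - 1ℤ
  +suc≤⇒≤pred a l c p = subst (λ z → z ≤ c - 1ℤ) (l1 a l) (ℤP.+-monoˡ-≤ (- 1ℤ) p)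
    where l1 : ∀ a l → (a + (1ℤ + l)) - 1ℤ ≡ a + l
          l1 = solve-∀

  pred+≤ : ∀ c x → c - 1ℤ + x ≤ c + x
  pred+≤ c x = subst (λ z → c - 1ℤ + x ≤ z) (l1 c x) (ℤP.<⇒≤ (<-suc (c - 1ℤ + x)))
    where l1 : ∀ c x → (c - 1ℤ + x) + 1ℤ ≡ c + x
          l1 = solve-∀

  c≤top : ∀ x c → 0 ℕ.< x → c ≤ topBead x c
  c≤top (suc x) c _ = +ℕ⇒≤ x (l (+ x) c)
    where l : ∀ x c → ((1ℤ + x) - 1ℤ) + c ≡ c + x
          l = solve-∀

  top<cx : ∀ x c → topBead x c < c + + x
  top<cx x c = +suc⇒< 0 (l (+ x) c)
    where l : ∀ x c → c + x ≡ ((x - 1ℤ) + c) + 1ℤ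
          l = solve-∀

  a≤a+l : ∀ a l → a ≤ a + + l
  a≤a+l a l = +ℕ⇒≤ l refl

  count-L : ∀ {c ν} a n → IsPartition ν → Wide a n c ν → a + + count (L-dec c ν) a n ≡ c
  count-L {c} {[]} a n P (g1 , g2) with ≤⇒+ℕ (subst (λ z → z ≤ c) (ℤP.+-identityʳ a) g1)
  ... | j , eq = trans (cong (λ z → a + + z) (count-L[] c a j n eq jn)) (sym eq)
    where jn : j ℕ.≤ n
          jn = ℤP.drop‿+≤+ (cancelˡ-≤ a (+ j) (+ n) (subst (λ z → z ≤ a + + n) (trans (ℤP.+-identityʳ c) eq) g2))
  count-L {c} {x ∷ ν} a n P (g1 , g2) =
    trans (cong (λ z → a + + z) cp) (trans (r-s1 a (+ count (L-dec (c - 1ℤ) ν) a n))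
      (trans (cong (_+ 1ℤ) ih) (r-pm c)))
    where
    ih : a + + count (L-dec (c - 1ℤ) ν) a n ≡ c - 1ℤ
    ih = count-L a n (isPartition-tail P) (+suc≤⇒≤pred a (+ length ν) c g1 ,
          ℤP.≤-trans (ℤP.+-monoʳ-≤ (c - 1ℤ) (ℤ.+≤+ (head≤ P))) (ℤP.≤-trans (pred+≤ c (+ x)) g2))
    m = topBead x c
    a≤m : a ≤ m
    a≤m = ℤP.≤-trans (a≤a+l a (length (x ∷ ν))) (ℤP.≤-trans g1 (c≤top x c (isPartition-head>0 P)))
    m< : m < a + + n
    m< = ℤP.<-≤-trans (top<cx x c) g2
    cp : count (L-dec c (x ∷ ν)) a n ≡ suc (count (L-dec (c - 1ℤ) ν) a n)
    cp = count-insert (L-dec (c - 1ℤ) ν) (L-dec c (x ∷ ν)) m a n (λ k → L-cons⇒ , L-cons⇐)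
           (λ pm → ℤP.<-irrefl refl (tail<topBead P pm)) a≤m m<

  ≤abs : ∀ c → c ≤ + ∣ c ∣
  ≤abs (+ n) = ℤP.≤-refl
  ≤abs -[1+ n ] = ℤ.-≤+

  -abs≤ : ∀ c → - + ∣ c ∣ ≤ c
  -abs≤ (+ zero) = ℤP.≤-refl
  -abs≤ (+ suc n) = ℤ.-≤+
  -abs≤ -[1+ n ] = ℤP.≤-refl

  r-win1 : ∀ C L H R → - (((C + L) + H) + R) + L + (H + R) ≡ - C
  r-win1 = solve-∀
  r-win2 : ∀ C L H R → - (((C + L) + H) + R) + ((((C + L) + H) + R) + (((C + L) + H) + R)) ≡ (C + H) + (L + R)
  r-win2 = solve-∀

  pos4 : ∀ C L H R → + (((C ℕ.+ L) ℕ.+ H) ℕ.+ R) ≡ ((+ C + + L) + + H) + + R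
  pos4 C L H R rewrite ℤP.pos-+ ((C ℕ.+ L) ℕ.+ H) R | ℤP.pos-+ (C ℕ.+ L) H | ℤP.pos-+ C L = refl

  spread : ℤ → Partition → ℕ
  spread c ν = ∣ c ∣ ℕ.+ length ν ℕ.+ part ν 0

  wide-window : ∀ c ν B → spread c ν ℕ.≤ B → Wide (- + B) (B ℕ.+ B) c ν
  wide-window c ν B le with ℕP.m≤n⇒∃[o]m+o≡n le
  ... | R , refl =
    ℤP.≤-trans (+ℕ⇒≤ (part ν 0 ℕ.+ R) (sym (trans (cong (λ z → - z + + length ν + + (part ν 0 ℕ.+ R)) eB)
         (trans (cong (λ z → - BB + + length ν + z) (ℤP.pos-+ (part ν 0) R)) (r-win1 C L H (+ R)))))) (-abs≤ c)
    , ℤP.≤-trans (ℤP.+-monoˡ-≤ H (≤abs c))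
        (+ℕ⇒≤ (length ν ℕ.+ R) ((trans (cong (λ z → - + B′ + z) (ℤP.pos-+ B′ B′))
          (trans (cong (λ z → - z + (z + z)) eB)
          (trans (r-win2 C L H (+ R)) (cong (λ z → (C + H) + z) (sym (ℤP.pos-+ (length ν) R))))))))
    where
    C = + ∣ c ∣
    L = + length ν
    H = + part ν 0
    B′ = ∣ c ∣ ℕ.+ length ν ℕ.+ part ν 0 ℕ.+ R
    BB = ((C + L) + H) + + R
    eB : + B′ ≡ BB
    eB = pos4 ∣ c ∣ (length ν) (part ν 0) R

  r-low : ∀ k l r → ((k + (1ℤ + l)) + r) - 1ℤ ≡ (k + l) + r
  r-low = solve-∀

  L-low : ∀ {c ν k} → k + + length ν < c → LSet c ν k
  L-low {c} {[]} {k} p = <⇒L[] (subst (λ z → z < c) (ℤP.+-identityʳ k) p)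
  L-low {c} {x ∷ ν} {k} p with <⇒+suc p
  ... | r , eq = L-cons⇐ {c} {x} {ν} (inj₂ (L-low {c - 1ℤ} {ν} (+suc⇒< r (trans (cong (_- 1ℤ) eq) (r-low k (+ length ν) (+ suc r))))))

  module JointWindow (c d : ℤ) (ν ν′ : Partition) where
    B : ℕ
    B = spread c ν ℕ.+ spread d ν′
    a : ℤ
    a = - + B
    n : ℕ
    n = B ℕ.+ B
    wide₁ : Wide a n c ν
    wide₁ = wide-window c ν B (ℕP.m≤m+n (spread c ν) (spread d ν′))
    wide₂ : Wide a n d ν′
    wide₂ = wide-window d ν′ B (ℕP.m≤n+m (spread d ν′) (spread c ν))

  ⊆⇒charge≤ : ∀ {c d ν ν′} → IsPartition ν → IsPartition ν′ → LSet c ν ⊆ℤ LSet d ν′ → c ≤ d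
  ⊆⇒charge≤ {c} {d} {ν} {ν′} P P′ inc =
    subst₂ _≤_ (count-L a n P wide₁) (count-L a n P′ wide₂)
      (ℤP.+-monoʳ-≤ a (ℤ.+≤+ (count-mono (L-dec c ν) (L-dec d ν′) a n inc)))
    where open JointWindow c d ν ν′

  count≤⇒⊇ : ∀ {c d ν ν′} a n → IsPartition ν → IsPartition ν′ → Wide a n c ν → Wide a n d ν′ →
    LSet c ν ⊆ℤ LSet d ν′ → count (L-dec d ν′) a n ℕ.≤ count (L-dec c ν) a n → LSet d ν′ ⊆ℤ LSet c ν
  count≤⇒⊇ {c} {d} {ν} {ν′} a n P P′ g1 g2 inc le k q with ≤⊎> a k
  ... | inj₂ k<a = L-low {c} {ν} (ℤP.<-≤-trans (ℤP.+-monoˡ-< (+ length ν) k<a) (proj₁ g1))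
  ... | inj₁ a≤k with ≤⊎> (a + + n) k
  ...   | inj₁ end≤k = ⊥-elim (ℤP.<-irrefl refl (ℤP.<-≤-trans (L-bound P′ q) (ℤP.≤-trans (ℤP.≤-reflexive (ℤP.+-comm (+ part ν′ 0) d)) (ℤP.≤-trans (proj₂ g2) end≤k))))
  ...   | inj₂ k<an = count-≤⇒⊇ (L-dec c ν) (L-dec d ν′) a n inc le k a≤k k<an q

  ⊆∧charge≥⇒⊇ : ∀ {c d ν ν′} → IsPartition ν → IsPartition ν′ → LSet c ν ⊆ℤ LSet d ν′ → d ≤ c → LSet d ν′ ⊆ℤ LSet c ν
  ⊆∧charge≥⇒⊇ {c} {d} {ν} {ν′} P P′ inc d≤c = count≤⇒⊇ a n P P′ wide₁ wide₂ inc (ℕP.≤-reflexive (sym counts≡))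
    where
    open JointWindow c d ν ν′
    c≡d : c ≡ d
    c≡d = ℤP.≤-antisym (⊆⇒charge≤ P P′ inc) d≤c
    counts≡ : count (L-dec c ν) a n ≡ count (L-dec d ν′) a n
    counts≡ = ℤP.+-injective (+-cancelˡ a _ _ (trans (count-L a n P wide₁) (trans c≡d (sym (count-L a n P′ wide₂)))))

-- The Uglov set U of an l-multipartition and its runner decomposition: U is decidable,
-- each period of e·l integers contains one block of e consecutive integers of each
-- component, hence U is a Maya set of charge Σ s_i, and conversely a Maya set splits into
-- l components.
module UglovDecomposition where

  open import Defs
  open IntegerFacts
  open MayaSets
  open PartitionOfSet
  open Counting
  open import Data.Nat as ℕ using (ℕ; zero; suc; _∸_)
  import Data.Nat.Properties as ℕP
  import Data.Nat.DivMod as ℕD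
  open import Data.Integer as ℤ using (ℤ; +_; _+_; _-_; _*_; -_; _≤_; _<_; 0ℤ; 1ℤ; _/ℕ_; _%ℕ_)
  import Data.Integer.Properties as ℤP
  import Data.Integer.DivMod as ℤD
  open import Data.Integer.Tactic.RingSolver
  open import Data.Fin as F using (Fin; toℕ; fromℕ<)
  import Data.Fin.Properties as FP
  open import Data.Vec as V using (Vec; lookup)
  open import Data.List using ([]; _∷_; length)
  open import Data.Product
  open import Data.Sum
  open import Data.Empty
  open import Function using (_∘_)
  open import Relation.Binary.PropositionalEquality
  open import Relation.Nullary
  open import Relation.Unary using (Decidable)
  open import Relation.Binary.Definitions using (tri<; tri≈; tri>)
  open import Algebra.Properties.CommutativeSemigroup ℕP.+-commutativeSemigroup using () renaming (interchange to +-interchange)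

  -- Euclidean division with remainder is unique: a larger quotient would force R ≥ D.
  r-du : ∀ q t D R R′ → q * D + R ≡ (q + t) * D + R′ → R ≡ R′ + t * D
  r-du q t D R R′ eq = trans (l1 q D R) (trans (cong (λ z → z - q * D) eq) (l2 q t D R′))
    where l1 : ∀ q D R → R ≡ (q * D + R) - q * D
          l1 = solve-∀
          l2 : ∀ q t D R′ → ((q + t) * D + R′) - q * D ≡ R′ + t * D
          l2 = solve-∀

  divmod-unique-< : ∀ D q t R R′ → R ℕ.< D → q * + D + + R ≡ (q + + suc t) * + D + + R′ → ⊥
  divmod-unique-< D q t R R′ R<D eq = ℕP.<-irrefl refl (ℕP.<-≤-trans R<D (ℕP.≤-trans (ℕP.m≤m+n D (t ℕ.* D)) (ℕP.≤-trans (ℕP.m≤n+m (suc t ℕ.* D) R′) (ℕP.≤-reflexive (sym e2)))))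
    where
    e1 : + R ≡ + R′ + + suc t * + D
    e1 = r-du q (+ suc t) (+ D) (+ R) (+ R′) eq
    e2 : R ≡ R′ ℕ.+ suc t ℕ.* D
    e2 = ℤP.+-injective (trans e1 (trans (cong (λ z → + R′ + z) (sym (ℤP.pos-* (suc t) D))) (sym (ℤP.pos-+ R′ (suc t ℕ.* D)))))

  divmod-unique : ∀ D q q′ R R′ → R ℕ.< D → R′ ℕ.< D → q * + D + + R ≡ q′ * + D + + R′ → q ≡ q′ × R ≡ R′
  divmod-unique D q q′ R R′ p p′ eq with ℤP.<-cmp q q′
  ... | tri< a _ _ with <⇒+suc a
  ...   | t , refl = ⊥-elim (divmod-unique-< D q t R R′ p eq)
  divmod-unique D q q′ R R′ p p′ eq | tri> _ _ c with <⇒+suc c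
  ...   | t , refl = ⊥-elim (divmod-unique-< D q′ t R′ R p′ (sym eq))
  divmod-unique D q q′ R R′ p p′ eq | tri≈ _ refl _ = refl , ℤP.+-injective (+-cancelˡ (q * + D) _ _ eq)

  module DivModE (e : ℕ) .{{_ : ℕ.NonZero e}} where
    qq : ℤ → ℤ
    qq k = k /ℕ e
    rr : ℤ → ℕ
    rr k = k %ℕ e
    rr<e : ∀ k → rr k ℕ.< e
    rr<e k = ℤD.n%ℕd<d k e
    kdec : ∀ k → k ≡ qq k * + e + + rr k
    kdec k = trans (ℤD.a≡a%ℕn+[a/ℕn]*n k e) (ℤP.+-comm (+ rr k) (qq k * + e))
    kuniq : ∀ q r → r ℕ.< e → qq (q * + e + + r) ≡ q × rr (q * + e + + r) ≡ r
    kuniq q r r<e = divmod-unique e (qq k) q (rr k) r (rr<e k) r<e (sym (kdec k))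
      where k = q * + e + + r

  Σℕ : ∀ {K} → (Fin K → ℕ) → ℕ
  Σℕ {zero} G = 0
  Σℕ {suc K} G = G F.zero ℕ.+ Σℕ (G ∘ F.suc)

  Σℤ : ∀ {K} → (Fin K → ℤ) → ℤ
  Σℤ {zero} G = 0ℤ
  Σℤ {suc K} G = G F.zero + Σℤ (G ∘ F.suc)

  Σℕ-zero : ∀ K → Σℕ {K} (λ _ → 0) ≡ 0
  Σℕ-zero zero = refl
  Σℕ-zero (suc K) = Σℕ-zero K

  Σℕ-+ : ∀ {K} (f g : Fin K → ℕ) → Σℕ (λ i → f i ℕ.+ g i) ≡ Σℕ f ℕ.+ Σℕ g
  Σℕ-+ {zero} f g = refl
  Σℕ-+ {suc K} f g rewrite Σℕ-+ (f ∘ F.suc) (g ∘ F.suc) = +-interchange (f F.zero) (g F.zero) (Σℕ (f ∘ F.suc)) (Σℕ (g ∘ F.suc))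

  Σℕ-≥ : ∀ {K} (G : Fin K → ℕ) i → G i ℕ.≤ Σℕ G
  Σℕ-≥ G F.zero = ℕP.m≤m+n _ _
  Σℕ-≥ G (F.suc i) = ℕP.≤-trans (Σℕ-≥ (G ∘ F.suc) i) (ℕP.m≤n+m _ _)

  Σℕ-cong : ∀ {K} (f g : Fin K → ℕ) → (∀ i → f i ≡ g i) → Σℕ f ≡ Σℕ g
  Σℕ-cong {zero} f g h = refl
  Σℕ-cong {suc K} f g h = cong₂ ℕ._+_ (h F.zero) (Σℕ-cong (f ∘ F.suc) (g ∘ F.suc) (h ∘ F.suc))

  Σℤ-pos : ∀ {K} (G : Fin K → ℕ) → + Σℕ G ≡ Σℤ (λ i → + G i)
  Σℤ-pos {zero} G = refl
  Σℤ-pos {suc K} G = trans (ℤP.pos-+ (G F.zero) (Σℕ (G ∘ F.suc))) (cong (λ z → + G F.zero + z) (Σℤ-pos (G ∘ F.suc)))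

  Σℤ-cong : ∀ {K} (f g : Fin K → ℤ) → (∀ i → f i ≡ g i) → Σℤ f ≡ Σℤ g
  Σℤ-cong {zero} f g h = refl
  Σℤ-cong {suc K} f g h = cong₂ _+_ (h F.zero) (Σℤ-cong (f ∘ F.suc) (g ∘ F.suc) (h ∘ F.suc))

  Σℤ-sub : ∀ {K} (f : Fin K → ℤ) c → Σℤ (λ i → f i - c) ≡ Σℤ f - + K * c
  Σℤ-sub {zero} f c = l c
    where l : ∀ c → 0ℤ ≡ 0ℤ - 0ℤ * c
          l = solve-∀
  Σℤ-sub {suc K} f c rewrite Σℤ-sub (f ∘ F.suc) c = l (f F.zero) (Σℤ (f ∘ F.suc)) (+ K) c
    where l : ∀ a S K c → a - c + (S - K * c) ≡ a + S - (1ℤ + K) * c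
          l = solve-∀

  sumℤ≡Σℤ : ∀ {K} (s : Vec ℤ K) → sumℤ s ≡ Σℤ (lookup s)
  sumℤ≡Σℤ V.[] = refl
  sumℤ≡Σℤ (x V.∷ s) = cong (λ z → x + z) (sumℤ≡Σℤ s)

  count-translate : ∀ {P P′ : ℤ → Set} (dP : Decidable P) (dP′ : Decidable P′) a b n →
    (∀ r → r ℕ.< n → (P (a + + r) → P′ (b + + r)) × (P′ (b + + r) → P (a + + r))) →
    count dP a n ≡ count dP′ b n
  count-translate dP dP′ a b zero h = refl
  count-translate {P} {P′} dP dP′ a b (suc n) h = cong₂ ℕ._+_ hd
    (count-translate dP dP′ (a + 1ℤ) (b + 1ℤ) n (λ r r<n →
       let (f , g) = h (suc r) (ℕ.s≤s r<n) in
       (λ x → subst P′ (sym (r-w2 b (+ r))) (f (subst P (r-w2 a (+ r)) x)))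
     , (λ x → subst P (sym (r-w2 a (+ r))) (g (subst P′ (r-w2 b (+ r)) x)))))
    where
    hd : indicator (dP a) ≡ indicator (dP′ b)
    hd with h 0 (ℕ.s≤s ℕ.z≤n) | dP a | dP′ b
    ... | _ | yes _ | yes _ = refl
    ... | _ | no _ | no _ = refl
    ... | (f , g) | yes x | no ¬y = ⊥-elim (¬y (subst P′ (ℤP.+-identityʳ b) (f (subst P (sym (ℤP.+-identityʳ a)) x))))
    ... | (f , g) | no ¬x | yes y = ⊥-elim (¬x (subst P (ℤP.+-identityʳ a) (g (subst P′ (sym (ℤP.+-identityʳ b)) y))))

  wide-mono : ∀ {a n a′ n′ c ν} → a′ ≤ a → a + + n ≤ a′ + + n′ → Wide a n c ν → Wide a′ n′ c ν
  wide-mono p q (g1 , g2) = ℤP.≤-trans (ℤP.+-monoˡ-≤ _ p) g1 , ℤP.≤-trans g2 q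

  r-sc1 : ∀ B e → - B ≡ (- B * (1ℤ + e)) + B * e
  r-sc1 = solve-∀
  r-sc2 : ∀ B e → - B * (1ℤ + e) + ((B + B) * (1ℤ + e)) ≡ (- B + (B + B)) + B * e
  r-sc2 = solve-∀

  wide-scale : ∀ {c ν} B e′ → Wide (- + B) (B ℕ.+ B) c ν →
    Wide (- + B * + suc e′) ((B ℕ.+ B) ℕ.* suc e′) c ν
  wide-scale {c} {ν} B e′ g = wide-mono {a = - + B} {n = B ℕ.+ B} {a′ = - + B * + suc e′} {n′ = (B ℕ.+ B) ℕ.* suc e′} {c = c} {ν = ν}
    (+ℕ⇒≤ (B ℕ.* e′) (trans (r-sc1 (+ B) (+ e′)) (cong (λ z → - + B * + suc e′ + z) (sym (ℤP.pos-* B e′)))))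
    (+ℕ⇒≤ (B ℕ.* e′) (trans (cong (λ z → - + B * + suc e′ + z) (trans (ℤP.pos-* (B ℕ.+ B) (suc e′)) (cong (_* + suc e′) (ℤP.pos-+ B B))))
       (trans (r-sc2 (+ B) (+ e′)) (cong₂ _+_ (cong (λ z → - + B + z) (sym (ℤP.pos-+ B B))) (sym (ℤP.pos-* B e′))))))
    g

  module Runners (e′ l′ : ℕ) where
    e : ℕ
    e = suc e′
    l : ℕ
    l = suc l′
    N : ℕ
    N = e ℕ.* l

    block : Fin l → ℕ
    block i = l ∸ suc (toℕ i)

    uglovPos : Fin l → ℤ → ℕ → ℤ
    uglovPos i q r = + ((l ∸ suc (toℕ i)) ℕ.* e) + q * + (e ℕ.* l) + + r

    r-F : ∀ A q N r → (A + q * N) + r ≡ q * N + (A + r)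
    r-F = solve-∀

    pos-split : ∀ i q r → uglovPos i q r ≡ q * + N + + (block i ℕ.* e ℕ.+ r)
    pos-split i q r = trans (r-F (+ (block i ℕ.* e)) q (+ N) (+ r)) (cong (λ z → q * + N + z) (sym (ℤP.pos-+ (block i ℕ.* e) r)))

    block≤ : ∀ i → block i ℕ.≤ l′
    block≤ i = ℕP.m∸n≤m l′ (toℕ i)

    offset<N : ∀ j r → j ℕ.≤ l′ → r ℕ.< e → j ℕ.* e ℕ.+ r ℕ.< N
    offset<N j r j≤ r<e = ℕP.<-≤-trans (ℕP.+-monoʳ-< (j ℕ.* e) r<e)
      (ℕP.≤-trans (ℕP.≤-reflexive (ℕP.+-comm (j ℕ.* e) e))
      (ℕP.≤-trans (ℕP.*-monoˡ-≤ e (ℕ.s≤s j≤)) (ℕP.≤-reflexive (ℕP.*-comm l e))))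

    pos-offset : ∀ j r → + (j ℕ.* e ℕ.+ r) ≡ + j * + e + + r
    pos-offset j r = trans (ℤP.pos-+ (j ℕ.* e) r) (cong (_+ + r) (ℤP.pos-* j e))

    pos-injective : ∀ i i′ q q′ r r′ → r ℕ.< e → r′ ℕ.< e → uglovPos i q r ≡ uglovPos i′ q′ r′ → i ≡ i′ × q ≡ q′ × r ≡ r′
    pos-injective i i′ q q′ r r′ p p′ eq with divmod-unique N q q′ _ _ (offset<N (block i) r (block≤ i) p) (offset<N (block i′) r′ (block≤ i′) p′)
                                         (trans (sym (pos-split i q r)) (trans eq (pos-split i′ q′ r′)))
    ... | refl , Req with divmod-unique e (+ block i) (+ block i′) r r′ p p′ (trans (sym (pos-offset (block i) r)) (trans (cong +_ Req) (pos-offset (block i′) r′)))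
    ... | jeq , refl = FP.toℕ-injective (ℕP.∸-cancelˡ-≡ (ℕP.≤-pred (FP.toℕ<n i)) (ℕP.≤-pred (FP.toℕ<n i′)) (ℤP.+-injective jeq)) , refl , refl

    pos-surjective : ∀ m → Σ[ i ∈ Fin l ] Σ[ q ∈ ℤ ] Σ[ r ∈ ℕ ] (r ℕ.< e × m ≡ uglovPos i q r)
    pos-surjective m = i , Q , r , ℕD.m%n<n R e , eqm
      where
      Q = m /ℕ N
      R = m %ℕ N
      j = R ℕ./ e
      r = R ℕ.% e
      j<l : j ℕ.< l
      j<l = ℕD.m<n*o⇒m/o<n (subst (R ℕ.<_) (ℕP.*-comm e l) (ℤD.n%ℕd<d m N))
      i : Fin l
      i = fromℕ< {l′ ∸ j} (ℕ.s≤s (ℕP.m∸n≤m l′ j))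
      ji : block i ≡ j
      ji = trans (cong (l′ ∸_) (FP.toℕ-fromℕ< (ℕ.s≤s (ℕP.m∸n≤m l′ j)))) (ℕP.m∸[m∸n]≡n (ℕP.≤-pred j<l))
      Rdec : R ≡ r ℕ.+ j ℕ.* e
      Rdec = ℕD.m≡m%n+[m/n]*n R e
      eqm : m ≡ uglovPos i Q r
      eqm = begin
        m ≡⟨ ℤD.a≡a%ℕn+[a/ℕn]*n m N ⟩
        + R + Q * + N ≡⟨ cong (λ z → + z + Q * + N) (trans Rdec (ℕP.+-comm r (j ℕ.* e))) ⟩
        + (j ℕ.* e ℕ.+ r) + Q * + N ≡⟨ ℤP.+-comm _ (Q * + N) ⟩
        Q * + N + + (j ℕ.* e ℕ.+ r) ≡⟨ cong (λ z → Q * + N + + (z ℕ.* e ℕ.+ r)) (sym ji) ⟩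
        Q * + N + + (block i ℕ.* e ℕ.+ r) ≡⟨ sym (pos-split i Q r) ⟩
        uglovPos i Q r ∎
        where open ≡-Reasoning

    module _ (s : Vec ℤ l) (λs : Vec Partition l) where
      X : Fin l → ℤ → Set
      X i = LSet (lookup s i) (lookup λs i)
      dX : ∀ i → Decidable (X i)
      dX i = L-dec (lookup s i) (lookup λs i)

      U : ℤ → Set
      U = UglovSet e s λs

      U⇒X : ∀ i q r → r ℕ.< e → U (uglovPos i q r) → X i (q * + e + + r)
      U⇒X i q r r<e (i′ , q′ , r′ , r′<e , x , eq) with pos-injective i i′ q q′ r r′ r<e r′<e eq
      ... | refl , refl , refl = x

      X⇒U : ∀ i q r → r ℕ.< e → X i (q * + e + + r) → U (uglovPos i q r)
      X⇒U i q r r<e x = i , q , r , r<e , x , refl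

      U-dec : Decidable U
      U-dec m with pos-surjective m
      ... | i , q , r , r<e , eq with dX i (q * + e + + r)
      ...   | yes x = yes (i , q , r , r<e , x , eq)
      ...   | no ¬x = no (λ u → ¬x (U⇒X i q r r<e (subst U eq u)))

      r-blk : ∀ a b c → (a + b) + c ≡ (b + a) + c
      r-blk = solve-∀

      count-U-block : ∀ i Q → count U-dec (Q * + N + + (block i ℕ.* e)) e ≡ count (dX i) (Q * + e) e
      count-U-block i Q = count-translate U-dec (dX i) _ _ e (λ r r<e →
         (λ u → U⇒X i Q r r<e (subst U (eqF r) u)) , (λ x → subst U (sym (eqF r)) (X⇒U i Q r r<e x)))
        where eqF : ∀ r → (Q * + N + + (block i ℕ.* e)) + + r ≡ uglovPos i Q r
              eqF r = r-blk (Q * + N) (+ (block i ℕ.* e)) (+ r)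

      count-U-blocks : ∀ K (G : Fin K → ℕ) base → (∀ (i : Fin K) → count U-dec (base + + ((K ∸ suc (toℕ i)) ℕ.* e)) e ≡ G i) →
               count U-dec base (K ℕ.* e) ≡ Σℕ G
      count-U-blocks zero G base h = refl
      count-U-blocks (suc K) G base h = begin
        count U-dec base (e ℕ.+ K ℕ.* e) ≡⟨ cong (count U-dec base) (ℕP.+-comm e (K ℕ.* e)) ⟩
        count U-dec base (K ℕ.* e ℕ.+ e) ≡⟨ count-split U-dec base (K ℕ.* e) e ⟩
        count U-dec base (K ℕ.* e) ℕ.+ count U-dec (base + + (K ℕ.* e)) e ≡⟨ cong₂ ℕ._+_ (count-U-blocks K (G ∘ F.suc) base (h ∘ F.suc)) (h F.zero) ⟩
        Σℕ (G ∘ F.suc) ℕ.+ G F.zero ≡⟨ ℕP.+-comm (Σℕ (G ∘ F.suc)) (G F.zero) ⟩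
        Σℕ G ∎
        where open ≡-Reasoning

      r-q1 : ∀ Q N → Q * N + N ≡ (Q + 1ℤ) * N
      r-q1 = solve-∀

      count-U-periods : ∀ M Q → count U-dec (Q * + N) (M ℕ.* N) ≡ Σℕ (λ i → count (dX i) (Q * + e) (M ℕ.* e))
      count-U-periods zero Q = sym (Σℕ-zero l)
      count-U-periods (suc M) Q = begin
        count U-dec (Q * + N) (N ℕ.+ M ℕ.* N) ≡⟨ count-split U-dec (Q * + N) N (M ℕ.* N) ⟩
        count U-dec (Q * + N) N ℕ.+ count U-dec (Q * + N + + N) (M ℕ.* N)
          ≡⟨ cong₂ ℕ._+_ (trans (cong (count U-dec (Q * + N)) (ℕP.*-comm e l)) (count-U-blocks l _ (Q * + N) (λ i → count-U-block i Q)))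
                         (trans (cong (λ z → count U-dec z (M ℕ.* N)) (r-q1 Q (+ N))) (count-U-periods M (Q + 1ℤ))) ⟩
        Σℕ (λ i → count (dX i) (Q * + e) e) ℕ.+ Σℕ (λ i → count (dX i) ((Q + 1ℤ) * + e) (M ℕ.* e))
          ≡⟨ sym (Σℕ-+ (λ i → count (dX i) (Q * + e) e) (λ i → count (dX i) ((Q + 1ℤ) * + e) (M ℕ.* e))) ⟩
        Σℕ (λ i → count (dX i) (Q * + e) e ℕ.+ count (dX i) ((Q + 1ℤ) * + e) (M ℕ.* e))
          ≡⟨ Σℕ-cong _ _ (λ i → sym (trans (count-split (dX i) (Q * + e) e (M ℕ.* e))
                (cong (λ z → count (dX i) (Q * + e) e ℕ.+ count (dX i) z (M ℕ.* e)) (r-q1 Q (+ e))))) ⟩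
        Σℕ (λ i → count (dX i) (Q * + e) (e ℕ.+ M ℕ.* e)) ∎
        where open ≡-Reasoning

      r-c1 : ∀ Q e c s → Q * e + c ≡ s → c ≡ s - Q * e
      r-c1 Q e c s refl = lc Q e c
        where lc : ∀ Q e c → c ≡ (Q * e + c) - Q * e
              lc = solve-∀

      r-c2 : ∀ Q e l S → Q * (e * l) + (S - l * (Q * e)) ≡ S
      r-c2 = solve-∀

      -- If U is the Maya set L_t(μ), then t = Σ s_i: count both sides in a common wide window.
      uglov-charge : ∀ t μ → (∀ i → IsPartition (lookup λs i)) → IsPartition μ → SameSet (LSet t μ) U → t ≡ sumℤ s
      uglov-charge t μ Ps P S = begin
        t ≡⟨ sym cμ ⟩
        Q * + N + + count (L-dec t μ) (Q * + N) (M ℕ.* N) ≡⟨ cong (λ z → Q * + N + + z)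
             (trans (count-cong (L-dec t μ) U-dec (Q * + N) (M ℕ.* N) (λ k _ _ → proj₁ S k , proj₂ S k)) (count-U-periods M Q)) ⟩
        Q * + N + + Σℕ (λ i → count (dX i) (Q * + e) (M ℕ.* e)) ≡⟨ cong (λ z → Q * + N + z) (Σℤ-pos (λ i → count (dX i) (Q * + e) (M ℕ.* e))) ⟩
        Q * + N + Σℤ (λ i → + count (dX i) (Q * + e) (M ℕ.* e)) ≡⟨ cong (λ z → Q * + N + z)
             (trans (Σℤ-cong (λ i → + count (dX i) (Q * + e) (M ℕ.* e)) (λ i → lookup s i - Q * + e) (λ i → r-c1 Q (+ e) _ _ (ci i))) (Σℤ-sub (lookup s) (Q * + e))) ⟩
        Q * + N + (Σℤ (lookup s) - + l * (Q * + e)) ≡⟨ cong (λ z → Q * z + (Σℤ (lookup s) - + l * (Q * + e))) (ℤP.pos-* e l) ⟩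
        Q * (+ e * + l) + (Σℤ (lookup s) - + l * (Q * + e)) ≡⟨ r-c2 Q (+ e) (+ l) (Σℤ (lookup s)) ⟩
        Σℤ (lookup s) ≡⟨ sym (sumℤ≡Σℤ s) ⟩
        sumℤ s ∎
        where
        open ≡-Reasoning
        B : ℕ
        B = Σℕ (λ i → spread (lookup s i) (lookup λs i)) ℕ.+ spread t μ
        Q : ℤ
        Q = - + B
        M : ℕ
        M = B ℕ.+ B
        ci : ∀ i → Q * + e + + count (dX i) (Q * + e) (M ℕ.* e) ≡ lookup s i
        ci i = count-L (Q * + e) (M ℕ.* e) (Ps i) (wide-scale {lookup s i} {lookup λs i} B e′ (wide-window (lookup s i) (lookup λs i) B
                 (ℕP.≤-trans (Σℕ-≥ (λ i → spread (lookup s i) (lookup λs i)) i) (ℕP.m≤m+n _ _))))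
        cμ : Q * + N + + count (L-dec t μ) (Q * + N) (M ℕ.* N) ≡ t
        cμ = count-L (Q * + N) (M ℕ.* N) P (wide-scale {t} {μ} B (l′ ℕ.+ e′ ℕ.* suc l′) (wide-window t μ B (ℕP.m≤n+m (spread t μ) (Σℕ (λ i → spread (lookup s i) (lookup λs i))))))

  *-monoʳ-≤ℕ : ∀ {a b} (n : ℕ) → a ≤ b → a * + n ≤ b * + n
  *-monoʳ-≤ℕ n p = ℤP.*-monoʳ-≤-nonNeg (+ n) p

  r-qb : ∀ q D → q * D + D ≡ (q + 1ℤ) * D
  r-qb = solve-∀

  quot-low : ∀ D q R → q * + D ≤ q * + D + + R
  quot-low D q R = +ℕ⇒≤ R refl

  quot-high : ∀ D q R → R ℕ.< D → q * + D + + R < (q + 1ℤ) * + D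
  quot-high D q R R<D = subst (λ z → q * + D + + R < z) (r-qb q (+ D)) (ℤP.+-monoʳ-< (q * + D) (ℤ.+<+ R<D))

  quot-< : ∀ D q R Q → q * + D + + R < Q * + D → q < Q
  quot-< D q R Q p with ≤⊎> Q q
  ... | inj₂ q<Q = q<Q
  ... | inj₁ Q≤q = ⊥-elim (ℤP.<-irrefl refl (ℤP.<-≤-trans p (ℤP.≤-trans (*-monoʳ-≤ℕ D Q≤q) (quot-low D q R))))

  quot-≥ : ∀ D q R Q → R ℕ.< D → Q * + D ≤ q * + D + + R → Q ≤ q
  quot-≥ D q R Q R<D p with ≤⊎> Q q
  ... | inj₁ Q≤q = Q≤q
  ... | inj₂ q<Q = ⊥-elim (ℤP.<-irrefl refl (ℤP.<-≤-trans (quot-high D q R R<D) (ℤP.≤-trans (*-monoʳ-≤ℕ D (<-suc-≤ q<Q)) p)))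

  quot-<⁻¹ : ∀ D q R Q → R ℕ.< D → q < Q → q * + D + + R < Q * + D
  quot-<⁻¹ D q R Q R<D q<Q = ℤP.<-≤-trans (quot-high D q R R<D) (*-monoʳ-≤ℕ D (<-suc-≤ q<Q))

  quot-≥⁻¹ : ∀ D q R Q → Q ≤ q → Q * + D ≤ q * + D + + R
  quot-≥⁻¹ D q R Q Q≤q = ℤP.≤-trans (*-monoʳ-≤ℕ D Q≤q) (quot-low D q R)

  r-QM : ∀ Q M D → Q * D + M * D ≡ (Q + M) * D
  r-QM = solve-∀

  module RunnerBounds (e′ l′ : ℕ) where
    open Runners e′ l′
    open DivModE e

    block-offset<N : ∀ i r → r ℕ.< e → block i ℕ.* e ℕ.+ r ℕ.< N
    block-offset<N i r r<e = offset<N (block i) r (block≤ i) r<e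

    module UglovWindow (s : Vec ℤ l) (λs : Vec Partition l) (Ps : ∀ i → IsPartition (lookup λs i)) where
      B : ℕ
      B = Σℕ (λ i → spread (lookup s i) (lookup λs i))
      Q : ℤ
      Q = - + B
      M : ℕ
      M = B ℕ.+ B
      gi : ∀ i → Wide (Q * + e) (M ℕ.* e) (lookup s i) (lookup λs i)
      gi i = wide-scale {lookup s i} {lookup λs i} B e′ (wide-window (lookup s i) (lookup λs i) B (Σℕ-≥ (λ i → spread (lookup s i) (lookup λs i)) i))

      U-low : ∀ k → k < Q * + N → U s λs k
      U-low k p with pos-surjective k
      ... | i , q , r , r<e , refl = X⇒U s λs i q r r<e (L-low {lookup s i} {lookup λs i}
            (ℤP.<-≤-trans (ℤP.+-monoˡ-< (+ length (lookup λs i)) (quot-<⁻¹ e q r Q r<e q<Q)) (proj₁ (gi i))))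
        where q<Q : q < Q
              q<Q = quot-< N q _ Q (subst (λ z → z < Q * + N) (pos-split i q r) p)

      U-high : ∀ k → Q * + N + + (M ℕ.* N) ≤ k → ¬ U s λs k
      U-high k p u with pos-surjective k
      ... | i , q , r , r<e , refl = ℤP.<-irrefl refl (ℤP.<-≤-trans (L-bound (Ps i) x)
            (ℤP.≤-trans (ℤP.≤-reflexive (ℤP.+-comm _ (lookup s i))) (ℤP.≤-trans (proj₂ (gi i))
            (ℤP.≤-trans (ℤP.≤-reflexive (trans (cong (λ z → Q * + e + z) (ℤP.pos-* M e)) (r-QM Q (+ M) (+ e))))
              (quot-≥⁻¹ e q r (Q + + M) QM≤q)))))
        where
        x = U⇒X s λs i q r r<e u
        QM≤q : Q + + M ≤ q
        QM≤q = quot-≥ N q _ (Q + + M) (block-offset<N i r r<e)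
          (subst₂ _≤_ (trans (cong (λ z → Q * + N + z) (ℤP.pos-* M N)) (r-QM Q (+ M) (+ N))) (pos-split i q r) p)

      associatedU : Associated (U s λs)
      associatedU = associated (U s λs) (U-dec s λs) (Q * + N) (M ℕ.* N) U-low U-high

    module Components (n : ℤ) (μ : Partition) (P : IsPartition μ) where
      component : Fin l → ℤ → Set
      component i k = LSet n μ (uglovPos i (qq k) (rr k))
      component-dec : ∀ i → Decidable (component i)
      component-dec i k = L-dec n μ (uglovPos i (qq k) (rr k))
      B : ℕ
      B = spread n μ
      Q : ℤ
      Q = - + B
      M : ℕ
      M = B ℕ.+ B
      gμ : Wide (Q * + N) (M ℕ.* N) n μ
      gμ = wide-scale {n} {μ} B (l′ ℕ.+ e′ ℕ.* suc l′) (wide-window n μ B ℕP.≤-refl)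

      component-low : ∀ i k → k < Q * + e → component i k
      component-low i k p = L-low {n} {μ} (ℤP.<-≤-trans (ℤP.+-monoˡ-< (+ length μ)
          (subst (λ z → z < Q * + N) (sym (pos-split i (qq k) (rr k))) (quot-<⁻¹ N (qq k) _ Q (block-offset<N i (rr k) (rr<e k)) q<Q))) (proj₁ gμ))
        where q<Q : qq k < Q
              q<Q = quot-< e (qq k) (rr k) Q (subst (λ z → z < Q * + e) (kdec k) p)

      component-high : ∀ i k → Q * + e + + (M ℕ.* e) ≤ k → ¬ component i k
      component-high i k p c = ℤP.<-irrefl refl (ℤP.<-≤-trans (L-bound P c)
            (ℤP.≤-trans (ℤP.≤-reflexive (ℤP.+-comm _ n)) (ℤP.≤-trans (proj₂ gμ)
            (ℤP.≤-trans (ℤP.≤-reflexive (trans (cong (λ z → Q * + N + z) (ℤP.pos-* M N)) (r-QM Q (+ M) (+ N))))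
              (subst (λ z → (Q + + M) * + N ≤ z) (sym (pos-split i (qq k) (rr k))) (quot-≥⁻¹ N (qq k) _ (Q + + M) QM≤q))))))
        where
        QM≤q : Q + + M ≤ qq k
        QM≤q = quot-≥ e (qq k) (rr k) (Q + + M) (rr<e k)
          (subst₂ _≤_ (trans (cong (λ z → Q * + e + z) (ℤP.pos-* M e)) (r-QM Q (+ M) (+ e))) (kdec k) p)

      associatedComponent : ∀ i → Associated (component i)
      associatedComponent i = associated (component i) (component-dec i) (Q * + e) (M ℕ.* e) (component-low i) (component-high i)

      U-of-components : ∀ (s : Vec ℤ l) (λs : Vec Partition l) → (∀ i → SameSet (X s λs i) (component i)) → SameSet (U s λs) (LSet n μ)
      U-of-components s λs h = (λ m u → fw m u) , (λ m p → bw m p)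
        where
        fw : ∀ m → U s λs m → LSet n μ m
        fw m (i , q , r , r<e , x , refl) with kuniq q r r<e
        ... | e1 , e2 = subst (LSet n μ) (cong₂ (uglovPos i) e1 e2) (proj₁ (h i) _ x)
        bw : ∀ m → LSet n μ m → U s λs m
        bw m p with pos-surjective m
        ... | i , q , r , r<e , refl with kuniq q r r<e
        ...   | e1 , e2 = X⇒U s λs i q r r<e (proj₂ (h i) _ (subst (LSet n μ) (sym (cong₂ (uglovPos i) e1 e2)) p))

  -- Subtracting e from a position moves to the next component, wrapping around with
  -- q ↦ q - 1 after the last one; hence U is closed under k ↦ k - e iff the components form
  -- the cyclic chain.
  module RunnerShift (e′ l′ : ℕ) where
    open Runners e′ l′
    open DivModE e

    ∸-suc′ : ∀ t L → t ℕ.< L → L ∸ t ≡ suc (L ∸ suc t)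
    ∸-suc′ t L t<L = ℕP.+-∸-assoc 1 t<L

    r-st : ∀ E J QN R → (E + J + QN + R) - E ≡ J + QN + R
    r-st = solve-∀

    pos-step : ∀ i i′ q r → toℕ i′ ≡ suc (toℕ i) → uglovPos i q r - + e ≡ uglovPos i′ q r
    pos-step i i′ q r eq = begin
        + (block i ℕ.* e) + q * + N + + r - + e
          ≡⟨ cong (λ z → + (z ℕ.* e) + q * + N + + r - + e) (∸-suc′ (toℕ i) l′ ti<) ⟩
        + (e ℕ.+ (l′ ∸ suc (toℕ i)) ℕ.* e) + q * + N + + r - + e
          ≡⟨ cong (λ z → z + q * + N + + r - + e) (ℤP.pos-+ e _) ⟩
        + e + + ((l′ ∸ suc (toℕ i)) ℕ.* e) + q * + N + + r - + e
          ≡⟨ r-st (+ e) (+ ((l′ ∸ suc (toℕ i)) ℕ.* e)) (q * + N) (+ r) ⟩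
        + ((l′ ∸ suc (toℕ i)) ℕ.* e) + q * + N + + r
          ≡⟨ cong (λ z → + ((l′ ∸ z) ℕ.* e) + q * + N + + r) (sym eq) ⟩
        uglovPos i′ q r ∎
      where
      open ≡-Reasoning
      ti< : toℕ i ℕ.< l′
      ti< = ℕP.≤-pred (subst (λ z → z ℕ.< l) eq (FP.toℕ<n i′))

    r-wr : ∀ Q E L R → 0ℤ + Q * (E * (1ℤ + L)) + R - E ≡ L * E + (Q - 1ℤ) * (E * (1ℤ + L)) + R
    r-wr = solve-∀

    pos-wrap : ∀ i i′ q r → toℕ i ≡ l′ → toℕ i′ ≡ 0 → uglovPos i q r - + e ≡ uglovPos i′ (q - 1ℤ) r
    pos-wrap i i′ q r eq eq′ = begin
        + (block i ℕ.* e) + q * + N + + r - + e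
          ≡⟨ cong (λ z → + ((l′ ∸ z) ℕ.* e) + q * + N + + r - + e) eq ⟩
        + ((l′ ∸ l′) ℕ.* e) + q * + N + + r - + e
          ≡⟨ cong (λ z → + (z ℕ.* e) + q * + N + + r - + e) (ℕP.n∸n≡0 l′) ⟩
        0ℤ + q * + N + + r - + e
          ≡⟨ cong (λ z → 0ℤ + q * z + + r - + e) NN ⟩
        0ℤ + q * (+ e * (1ℤ + + l′)) + + r - + e
          ≡⟨ r-wr q (+ e) (+ l′) (+ r) ⟩
        + l′ * + e + (q - 1ℤ) * (+ e * (1ℤ + + l′)) + + r
          ≡⟨ cong₂ (λ a b → a + (q - 1ℤ) * b + + r) (sym (ℤP.pos-* l′ e)) (sym NN) ⟩
        + (l′ ℕ.* e) + (q - 1ℤ) * + N + + r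
          ≡⟨ cong (λ z → + ((l′ ∸ z) ℕ.* e) + (q - 1ℤ) * + N + + r) (sym eq′) ⟩
        uglovPos i′ (q - 1ℤ) r ∎
      where
      open ≡-Reasoning
      NN : + N ≡ + e * (1ℤ + + l′)
      NN = ℤP.pos-* e l

    r-km : ∀ q E r → (q - 1ℤ) * E + r ≡ (q * E + r) - E
    r-km = solve-∀

    module _ (s : Vec ℤ l) (λs : Vec Partition l) where
      -- The cyclic chain X_0 ⊆ X_1 ⊆ … ⊆ X_{l-1} and X_{l-1} - e ⊆ X_0 - e, i.e. X_{l-1} ⊆ L_{s_0+e}(λ^0).
      StepChain : Set
      StepChain = ∀ (i i′ : Fin l) → toℕ i′ ≡ suc (toℕ i) → X s λs i ⊆ℤ X s λs i′
      WrapChain : Set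
      WrapChain = ∀ (i i′ : Fin l) → toℕ i ≡ l′ → toℕ i′ ≡ 0 → ∀ k → X s λs i k → X s λs i′ (k - + e)

      chain⇒U-closed : StepChain → WrapChain → ∀ m → U s λs m → U s λs (m - + e)
      chain⇒U-closed c1 c2 m (i , q , r , r<e , x , refl) with toℕ i ℕ.≟ l′
      ... | yes eq = subst (U s λs) (sym (pos-wrap i F.zero q r eq refl))
            (X⇒U s λs F.zero (q - 1ℤ) r r<e (subst (X s λs F.zero) (sym (r-km q (+ e) (+ r))) (c2 i F.zero eq refl _ x)))
      ... | no ne = subst (U s λs) (sym (pos-step i i′ q r ti′))
            (X⇒U s λs i′ q r r<e (c1 i i′ ti′ _ x))
        where
        lt : suc (toℕ i) ℕ.< l
        lt = ℕ.s≤s (ℕP.≤∧≢⇒< (ℕP.≤-pred (FP.toℕ<n i)) ne)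
        i′ : Fin l
        i′ = fromℕ< lt
        ti′ : toℕ i′ ≡ suc (toℕ i)
        ti′ = FP.toℕ-fromℕ< lt

      U-closed⇒step : (∀ m → U s λs m → U s λs (m - + e)) → StepChain
      U-closed⇒step cl i i′ eq k x = subst (X s λs i′) (sym (kdec k))
         (U⇒X s λs i′ (qq k) (rr k) (rr<e k) (subst (U s λs) (pos-step i i′ (qq k) (rr k) eq)
           (cl _ (X⇒U s λs i (qq k) (rr k) (rr<e k) (subst (X s λs i) (kdec k) x)))))

      U-closed⇒wrap : (∀ m → U s λs m → U s λs (m - + e)) → WrapChain
      U-closed⇒wrap cl i i′ eq eq′ k x = subst (X s λs i′) (trans (r-km (qq k) (+ e) (+ rr k)) (cong (_- + e) (sym (kdec k))))
         (U⇒X s λs i′ (qq k - 1ℤ) (rr k) (rr<e k) (subst (U s λs) (pos-wrap i i′ (qq k) (rr k) eq eq′)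
           (cl _ (X⇒U s λs i (qq k) (rr k) (rr<e k) (subst (X s λs i) (kdec k) x)))))

-- The cyclic chain L_{c_0}(ν_0) ⊆ … ⊆ L_{c_{l-1}}(ν_{l-1}) ⊆ L_{c_0+e}(ν_0) is equivalent to
-- the permutation-invariant TotalChain condition: L_{c_i}(ν_i) ⊆ L_{c_j + ke}(ν_j) whenever
-- c_i ≤ c_j + ke.  TotalChain transfers along any reindexing that changes charges by
-- multiples of e, which relates the multicharge s to its sorted residues.
module ChainConditions where

  open import Defs
  open IntegerFacts
  open MayaSets
  open Counting
  open import Data.Nat as ℕ using (ℕ; zero; suc)
  import Data.Nat.Properties as ℕP
  open import Data.Integer as ℤ using (ℤ; +_; -[1+_]; _+_; _-_; _*_; -_; _≤_; _<_; 0ℤ; 1ℤ)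
  import Data.Integer.Properties as ℤP
  open import Data.Integer.Tactic.RingSolver
  open import Data.Fin as F using (Fin; toℕ; fromℕ<)
  import Data.Fin.Properties as FP
  open import Data.Product
  open import Data.Sum
  open import Data.Empty
  open import Relation.Binary.PropositionalEquality
  open import Relation.Nullary

  module Chains (e l′ : ℕ) where
    l : ℕ
    l = suc l′

    C : (Fin l → ℤ) → (Fin l → Partition) → Fin l → ℤ → Set
    C c ν i = LSet (c i) (ν i)

    Ch1 : (Fin l → ℤ) → (Fin l → Partition) → Set
    Ch1 c ν = ∀ (i i′ : Fin l) → toℕ i′ ≡ suc (toℕ i) → C c ν i ⊆ℤ C c ν i′
    Ch2 : (Fin l → ℤ) → (Fin l → Partition) → Set
    Ch2 c ν = ∀ (i i′ : Fin l) → suc (toℕ i) ≡ l → toℕ i′ ≡ 0 → C c ν i ⊆ℤ LSet (c i′ + + e) (ν i′)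
    TotalChain : (Fin l → ℤ) → (Fin l → Partition) → Set
    TotalChain c ν = ∀ (i i′ : Fin l) (k : ℤ) → c i ≤ c i′ + k * + e → C c ν i ⊆ℤ LSet (c i′ + k * + e) (ν i′)

    last : Fin l
    last = F.fromℕ l′

    ⊆-trans : ∀ {A B D : ℤ → Set} → A ⊆ℤ B → B ⊆ℤ D → A ⊆ℤ D
    ⊆-trans f g k x = g k (f k x)

    module _ (c : Fin l → ℤ) (ν : Fin l → Partition) (Ps : ∀ i → IsPartition (ν i)) where
      module _ (ch1 : Ch1 c ν) where
        chain-mono+ : ∀ d (i i′ : Fin l) → toℕ i′ ≡ toℕ i ℕ.+ d → C c ν i ⊆ℤ C c ν i′
        chain-mono+ zero i i′ eq with FP.toℕ-injective (trans eq (ℕP.+-identityʳ (toℕ i)))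
        ... | refl = λ k x → x
        chain-mono+ (suc d) i i′ eq = ⊆-trans (chain-mono+ d i i″ (FP.toℕ-fromℕ< lt)) (ch1 i″ i′ (trans eq (trans (ℕP.+-suc (toℕ i) d) (cong suc (sym (FP.toℕ-fromℕ< lt))))))
          where
          lt : toℕ i ℕ.+ d ℕ.< l
          lt = ℕP.≤-trans (ℕP.≤-reflexive (trans (sym (ℕP.+-suc (toℕ i) d)) (sym eq))) (ℕP.<⇒≤ (FP.toℕ<n i′))
          i″ : Fin l
          i″ = fromℕ< lt

        chain-mono : ∀ (i i′ : Fin l) → toℕ i ℕ.≤ toℕ i′ → C c ν i ⊆ℤ C c ν i′
        chain-mono i i′ le with ℕP.m≤n⇒∃[o]m+o≡n le
        ... | d , eq = chain-mono+ d i i′ (sym eq)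

        module _ (ch2 : Ch2 c ν) where
          chain-round : ∀ i i′ → C c ν i ⊆ℤ LSet (c i′ + + e) (ν i′)
          chain-round i i′ = ⊆-trans (chain-mono i last (subst (toℕ i ℕ.≤_) (sym (FP.toℕ-fromℕ l′)) (ℕP.≤-pred (FP.toℕ<n i))))
                    (⊆-trans (ch2 last F.zero (cong suc (FP.toℕ-fromℕ l′)) refl)
                      (⊆-shift {c F.zero} {c i′} {ν F.zero} {ν i′} (+ e) (chain-mono F.zero i′ ℕ.z≤n)))

          r-p1 : ∀ E → E ≡ 1ℤ * E
          r-p1 = solve-∀
          r-p2 : ∀ c E n → (c + E) + n * E ≡ c + (1ℤ + n) * E
          r-p2 = solve-∀

          chain-rounds : ∀ n i i′ → C c ν i ⊆ℤ LSet (c i′ + + suc n * + e) (ν i′)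
          chain-rounds zero i i′ k x = L-cong-charge {μ = ν i′} (cong (λ z → c i′ + z) (r-p1 (+ e))) (chain-round i i′ k x)
          chain-rounds (suc n) i i′ k x = L-cong-charge {μ = ν i′} (r-p2 (c i′) (+ e) (+ suc n))
            (⊆-shift {c i′} {c i′ + + e} {ν i′} {ν i′} (+ suc n * + e) (chain-round i′ i′) k (chain-rounds n i i′ k x))

          r-z : ∀ c E → c + 0ℤ * E ≡ c
          r-z = solve-∀
          r-neg : ∀ c a E → (c + a * E) + (- a) * E ≡ c
          r-neg = solve-∀

          -- The cyclic chain implies the total chain: for k ≤ 0 use charge comparison (⊆∧charge≥⇒⊇).
          chain⇒total : TotalChain c ν
          chain⇒total i i′ (+ zero) h with toℕ i ℕ.≤? toℕ i′
          ... | yes le = λ k x → L-cong-charge {μ = ν i′} (sym (r-z (c i′) (+ e))) (chain-mono i i′ le k x)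
          ... | no nle = λ k x → L-cong-charge {μ = ν i′} (sym (r-z (c i′) (+ e)))
                 (⊆∧charge≥⇒⊇ (Ps i′) (Ps i) (chain-mono i′ i (ℕP.<⇒≤ (ℕP.≰⇒> nle))) (subst (c i ≤_) (r-z (c i′) (+ e)) h) k x)
          chain⇒total i i′ (+ suc n) h = chain-rounds n i i′
          chain⇒total i i′ -[1+ n ] h = ⊆∧charge≥⇒⊇ (Ps i′) (Ps i) inc h
            where
            inc : LSet (c i′ + -[1+ n ] * + e) (ν i′) ⊆ℤ LSet (c i) (ν i)
            inc k x = L-cong-charge {μ = ν i} (r-neg (c i) (+ suc n) (+ e))
                       (⊆-shift {c i′} {c i + + suc n * + e} {ν i′} {ν i} (-[1+ n ] * + e) (chain-rounds n i′ i) k x)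

    r-t1 : ∀ a b ma mb k E → a + ma * E ≤ b + mb * E + k * E → a ≤ b + (k + mb - ma) * E
    r-t1 a b ma mb k E p = subst₂ _≤_ (l1 a ma E) (l2 b ma mb k E) (ℤP.+-monoˡ-≤ (- (ma * E)) p)
      where l1 : ∀ a ma E → a + ma * E + - (ma * E) ≡ a
            l1 = solve-∀
            l2 : ∀ b ma mb k E → b + mb * E + k * E + - (ma * E) ≡ b + (k + mb - ma) * E
            l2 = solve-∀
    r-t2 : ∀ b ma mb k E → (b + (k + mb - ma) * E) + ma * E ≡ (b + mb * E) + k * E
    r-t2 = solve-∀

    total-transfer : ∀ (c : Fin l → ℤ) (ν : Fin l → Partition) (c′ : Fin l → ℤ) (ν′ : Fin l → Partition)
      (π : Fin l → Fin l) (m : Fin l → ℤ) → (∀ j → c′ j ≡ c (π j) + m j * + e) → (∀ j → ν′ j ≡ ν (π j)) →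
      TotalChain c ν → TotalChain c′ ν′
    total-transfer c ν c′ ν′ π m hc hν tt j j′ k h x y
      rewrite hc j | hc j′ | hν j | hν j′ =
        L-cong-charge {μ = ν (π j′)} (r-t2 (c (π j′)) (m j) (m j′) k (+ e))
          (⊆-shift {c (π j)} {c (π j′) + (k + m j′ - m j) * + e} {ν (π j)} {ν (π j′)} (m j * + e)
             (tt (π j) (π j′) (k + m j′ - m j) (r-t1 (c (π j)) (c (π j′)) (m j) (m j′) k (+ e) h)) x y)

    r-o : ∀ c E → c ≡ c + 0ℤ * E
    r-o = solve-∀
    r-1 : ∀ c E → c + 1ℤ * E ≡ c + E
    r-1 = solve-∀

    total⇒step : ∀ c ν → TotalChain c ν → (∀ (i i′ : Fin l) → toℕ i′ ≡ suc (toℕ i) → c i ≤ c i′) → Ch1 c ν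
    total⇒step c ν tt h i i′ eq k x = L-cong-charge {μ = ν i′} (sym (r-o (c i′) (+ e)))
      (tt i i′ 0ℤ (subst (c i ≤_) (r-o (c i′) (+ e)) (h i i′ eq)) k x)

    total⇒wrap : ∀ c ν → TotalChain c ν → (∀ (i i′ : Fin l) → suc (toℕ i) ≡ l → toℕ i′ ≡ 0 → c i ≤ c i′ + + e) → Ch2 c ν
    total⇒wrap c ν tt h i i′ eq eq′ k x = L-cong-charge {μ = ν i′} (r-1 (c i′) (+ e))
      (tt i i′ 1ℤ (subst (c i ≤_) (sym (r-1 (c i′) (+ e))) (h i i′ eq eq′)) k x)

module SortingPermutation where

  open import Data.Nat as ℕ using (ℕ; zero; suc)
  import Data.Nat.Properties as ℕP
  open import Data.Fin as F using (Fin; toℕ)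
  import Data.Fin.Properties as FP
  open import Data.Fin.Permutation as Perm using (Permutation′; _⟨$⟩ʳ_; _⟨$⟩ˡ_; inverseˡ; lift₀; transpose; _∘ₚ_)
  import Data.Fin.Permutation.Components as PC
  open import Data.Product
  open import Data.Sum
  open import Data.Empty
  open import Function using (_∘_)
  open import Relation.Binary.PropositionalEquality
  open import Relation.Nullary
  open import Relation.Nullary.Decidable using (dec-true)

  transpose-fst : ∀ {n} (i j : Fin n) → PC.transpose i j i ≡ j
  transpose-fst i j rewrite dec-true (i FP.≟ i) refl = refl

  argmin : ∀ n (key : Fin (suc n) → ℕ) → Σ[ m ∈ Fin (suc n) ] (∀ j → key m ℕ.≤ key j)
  argmin zero key = F.zero , λ { F.zero → ℕP.≤-refl }
  argmin (suc n) key with argmin n (key ∘ F.suc)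
  ... | m′ , h with key F.zero ℕP.≤? key (F.suc m′)
  ...   | yes p = F.zero , λ { F.zero → ℕP.≤-refl ; (F.suc j) → ℕP.≤-trans p (h j) }
  ...   | no ¬p = F.suc m′ , λ { F.zero → ℕP.<⇒≤ (ℕP.≰⇒> ¬p) ; (F.suc j) → h j }

  perm-injective : ∀ {n} (σ : Permutation′ n) {a b} → σ ⟨$⟩ʳ a ≡ σ ⟨$⟩ʳ b → a ≡ b
  perm-injective σ {a} {b} eq = trans (sym (inverseˡ σ)) (trans (cong (σ ⟨$⟩ˡ_) eq) (inverseˡ σ))

  Sorted : ∀ {n} → (Fin n → ℕ) → Permutation′ n → Set
  Sorted {n} key σ = ∀ (i j : Fin n) → toℕ j ≡ suc (toℕ i) → key (σ ⟨$⟩ʳ i) ℕ.< key (σ ⟨$⟩ʳ j)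

  sortBy : ∀ n (key : Fin n → ℕ) → (∀ a b → key a ≡ key b → a ≡ b) → Σ[ σ ∈ Permutation′ n ] Sorted key σ
  sortBy zero key inj = Perm.id , λ ()
  sortBy (suc n) key inj with argmin n key
  ... | m , hm with sortBy n key′ inj′
    where
    τ = transpose F.zero m
    key′ : Fin n → ℕ
    key′ k = key (τ ⟨$⟩ʳ F.suc k)
    inj′ : ∀ a b → key′ a ≡ key′ b → a ≡ b
    inj′ a b eq = FP.suc-injective (perm-injective τ (inj _ _ eq))
  ... | ρ , hρ = σ , srt
    where
    τ = transpose F.zero m
    σ : Permutation′ (suc n)
    σ = lift₀ ρ ∘ₚ τ
    σ0 : σ ⟨$⟩ʳ F.zero ≡ m
    σ0 = transpose-fst F.zero m
    srt : Sorted key σ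
    srt F.zero (F.suc j) eq = ℕP.≤∧≢⇒< (subst (λ z → key z ℕ.≤ key (σ ⟨$⟩ʳ F.suc j)) (sym σ0) (hm _))
                               (λ e → 0≢s (perm-injective σ (inj _ _ e)))
      where 0≢s : F.zero ≢ F.suc j
            0≢s ()
    srt (F.suc i) (F.suc j) eq = hρ i j (ℕP.suc-injective eq)
    srt F.zero F.zero ()
    srt (F.suc i) F.zero ()

-- Sizes as sums of parts, and the size of a skew shape whose rows a..a+d satisfy the
-- rim-hook relation ν_i = λ_{i+1} - 1: it equals the difference of the two extreme beads.
module RowSums where

  open import Defs
  open IntegerFacts
  open MayaSets
  open import Data.Nat as ℕ using (ℕ; zero; suc)
  import Data.Nat.Properties as ℕP
  open import Data.Integer as ℤ using (ℤ; +_; _+_; _-_; -_; _≤_; _<_; 0ℤ; 1ℤ)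
  import Data.Integer.Properties as ℤP
  open import Data.Integer.Tactic.RingSolver
  open import Data.List using ([]; _∷_; length)
  open import Data.Product
  open import Data.Sum
  open import Data.Empty
  open import Function using (_∘_)
  open import Relation.Binary.PropositionalEquality
  open import Relation.Nullary

  ΣR : (ℕ → ℤ) → ℕ → ℕ → ℤ
  ΣR f lo zero = 0ℤ
  ΣR f lo (suc n) = f lo + ΣR f (suc lo) n

  ΣR-shift : ∀ f lo n → ΣR f (suc lo) n ≡ ΣR (f ∘ suc) lo n
  ΣR-shift f lo zero = refl
  ΣR-shift f lo (suc n) = cong (λ z → f (suc lo) + z) (ΣR-shift f (suc lo) n)

  ΣR-zero : ∀ f lo n → (∀ i → lo ℕ.≤ i → i ℕ.< lo ℕ.+ n → f i ≡ 0ℤ) → ΣR f lo n ≡ 0ℤ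
  ΣR-zero f lo zero h = refl
  ΣR-zero f lo (suc n) h = trans (cong₂ _+_ (h lo ℕP.≤-refl (ℕP.m<m+n lo (ℕ.s≤s ℕ.z≤n)))
    (ΣR-zero f (suc lo) n (λ i p q → h i (ℕP.<⇒≤ p) (subst (i ℕ.<_) (sym (ℕP.+-suc lo n)) q)))) refl

  ΣR-split : ∀ f lo m n → ΣR f lo (m ℕ.+ n) ≡ ΣR f lo m + ΣR f (lo ℕ.+ m) n
  ΣR-split f lo zero n = trans (cong (λ z → ΣR f z n) (sym (ℕP.+-identityʳ lo))) (sym (ℤP.+-identityˡ _))
  ΣR-split f lo (suc m) n = trans (cong (λ z → f lo + z) (trans (ΣR-split f (suc lo) m n)
     (cong (λ z → ΣR f (suc lo) m + ΣR f z n) (sym (ℕP.+-suc lo m))))) (sym (ℤP.+-assoc (f lo) _ _))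

  ΣR-sub : ∀ f g lo n → ΣR (λ i → f i - g i) lo n ≡ ΣR f lo n - ΣR g lo n
  ΣR-sub f g lo zero = refl
  ΣR-sub f g lo (suc n) = trans (cong (λ z → f lo - g lo + z) (ΣR-sub f g (suc lo) n)) (l (f lo) (g lo) (ΣR f (suc lo) n) (ΣR g (suc lo) n))
    where l : ∀ a b c d → a - b + (c - d) ≡ a + c - (b + d)
          l = solve-∀

  ΣR-cong : ∀ f g lo n → (∀ i → f i ≡ g i) → ΣR f lo n ≡ ΣR g lo n
  ΣR-cong f g lo zero h = refl
  ΣR-cong f g lo (suc n) h = cong₂ _+_ (h lo) (ΣR-cong f g (suc lo) n h)

  telescope : ∀ (v u : ℕ → ℤ) a d → (∀ i → a ℕ.≤ i → i ℕ.< a ℕ.+ d → u i ≡ v (suc i)) →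
    ΣR (λ i → v i - u i) a (suc d) ≡ v a - u (a ℕ.+ d)
  telescope v u a zero h = trans (ℤP.+-identityʳ _) (cong (λ z → v a - u z) (sym (ℕP.+-identityʳ a)))
  telescope v u a (suc d) h = begin
      (v a - u a) + ΣR (λ i → v i - u i) (suc a) (suc d)
        ≡⟨ cong (λ z → (v a - u a) + z) (telescope v u (suc a) d (λ i p q → h i (ℕP.<⇒≤ p) (subst (i ℕ.<_) (sym (ℕP.+-suc a d)) q))) ⟩
      (v a - u a) + (v (suc a) - u (suc a ℕ.+ d)) ≡⟨ cong (λ z → (v a - z) + (v (suc a) - u (suc a ℕ.+ d))) (h a ℕP.≤-refl (ℕP.m<m+n a (ℕ.s≤s ℕ.z≤n))) ⟩
      (v a - v (suc a)) + (v (suc a) - u (suc a ℕ.+ d)) ≡⟨ l (v a) (v (suc a)) (u (suc a ℕ.+ d)) ⟩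
      v a - u (suc a ℕ.+ d) ≡⟨ cong (λ z → v a - u z) (sym (ℕP.+-suc a d)) ⟩
      v a - u (a ℕ.+ suc d) ∎
    where open ≡-Reasoning
          l : ∀ x y z → (x - y) + (y - z) ≡ x - z
          l = solve-∀

  size≡ΣR : ∀ μ N → length μ ℕ.≤ N → ΣR (λ i → + part μ i) 0 N ≡ + size μ
  size≡ΣR [] N le = ΣR-zero _ 0 N (λ _ _ _ → refl)
  size≡ΣR (x ∷ μ) (suc N) (ℕ.s≤s le) = cong (λ z → + x + z) (trans (ΣR-shift (λ i → + part (x ∷ μ) i) 0 N)
     (trans (size≡ΣR μ N le) refl)) ⟨trans⟩ sym (ℤP.pos-+ x (size μ))
    where _⟨trans⟩_ = trans

  r-pq : ∀ p q i → p - q ≡ (p - i) - (q - i)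
  r-pq = solve-∀

  r-uv : ∀ p1 i → p1 - 1ℤ - i ≡ p1 - (1ℤ + i)
  r-uv = solve-∀

  size-difference : ∀ (λ′ ν : Partition) N a d →
    length λ′ ℕ.≤ N → length ν ℕ.≤ N → a ℕ.+ d ℕ.< N →
    (∀ i → i ℕ.< a → part ν i ≡ part λ′ i) →
    (∀ i → a ℕ.+ d ℕ.< i → part ν i ≡ part λ′ i) →
    (∀ i → a ℕ.≤ i → i ℕ.< a ℕ.+ d → + part ν i ≡ + part λ′ (suc i) - 1ℤ) →
    + size λ′ - + size ν ≡ (+ part λ′ a - + a) - (+ part ν (a ℕ.+ d) - + (a ℕ.+ d))
  size-difference λ′ ν N a d lλ lν b<N h1 h2 h3 = begin
      + size λ′ - + size ν ≡⟨ sym (cong₂ _-_ (size≡ΣR λ′ N lλ) (size≡ΣR ν N lν)) ⟩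
      ΣR p 0 N - ΣR q 0 N ≡⟨ sym (ΣR-sub p q 0 N) ⟩
      ΣR pq 0 N ≡⟨ cong (ΣR pq 0) (sym N≡) ⟩
      ΣR pq 0 (a ℕ.+ (suc d ℕ.+ r)) ≡⟨ ΣR-split pq 0 a (suc d ℕ.+ r) ⟩
      ΣR pq 0 a + ΣR pq a (suc d ℕ.+ r) ≡⟨ cong₂ _+_ (ΣR-zero pq 0 a (λ i _ q → z (h1 i q))) (ΣR-split pq a (suc d) r) ⟩
      0ℤ + (ΣR pq a (suc d) + ΣR pq (a ℕ.+ suc d) r) ≡⟨ cong (λ w → 0ℤ + (ΣR pq a (suc d) + w))
          (ΣR-zero pq (a ℕ.+ suc d) r (λ i p _ → z (h2 i (ℕP.<-≤-trans (ℕP.≤-reflexive (sym (ℕP.+-suc a d))) p)))) ⟩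
      0ℤ + (ΣR pq a (suc d) + 0ℤ) ≡⟨ trans (ℤP.+-identityˡ _) (ℤP.+-identityʳ _) ⟩
      ΣR pq a (suc d) ≡⟨ ΣR-cong pq (λ i → v i - u i) a (suc d) (λ i → r-pq (+ part λ′ i) (+ part ν i) (+ i)) ⟩
      ΣR (λ i → v i - u i) a (suc d) ≡⟨ telescope v u a d (λ i p q → trans (cong (_- + i) (h3 i p q)) (r-uv (+ part λ′ (suc i)) (+ i))) ⟩
      v a - u (a ℕ.+ d) ∎
    where
    open ≡-Reasoning
    p = λ i → + part λ′ i
    q = λ i → + part ν i
    pq = λ i → p i - q i
    v = λ i → + part λ′ i - + i
    u = λ i → + part ν i - + i
    z : ∀ {i} → part ν i ≡ part λ′ i → pq i ≡ 0ℤ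
    z {i} eq rewrite eq = ℤP.+-inverseʳ (+ part λ′ i)
    rr = ℕP.m≤n⇒∃[o]m+o≡n b<N
    r = proj₁ rr
    N≡ : a ℕ.+ (suc d ℕ.+ r) ≡ N
    N≡ = trans (sym (ℕP.+-assoc a (suc d) r)) (trans (cong (ℕ._+ r) (ℕP.+-suc a d)) (proj₂ rr))

module Beads where

  open import Defs
  open IntegerFacts
  open MayaSets
  open import Data.Nat as ℕ using (ℕ; zero; suc)
  import Data.Nat.Properties as ℕP
  open import Data.Integer as ℤ using (ℤ; +_; _+_; _-_; -_; _≤_; _<_)
  open import Data.List using ([]; _∷_; length)
  open import Data.List.Relation.Unary.All using ([]; _∷_)
  open import Data.Product
  open import Data.Sum
  open import Data.Empty
  open import Relation.Binary.PropositionalEquality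
  open import Relation.Nullary

  Bead : Partition → ℤ → Set
  Bead μ k = ∃[ i ] (k ≡ + part μ i - + i)

  Closed : ℕ → Partition → Set
  Closed e μ = ∀ k → Bead μ k → Bead μ (k - + e)

  part-beyond : ∀ μ i → length μ ℕ.≤ i → part μ i ≡ 0
  part-beyond [] i le = refl
  part-beyond (x ∷ μ) (suc i) (ℕ.s≤s le) = part-beyond μ i le

  part-pos : ∀ {μ} → IsPartition μ → ∀ i → i ℕ.< length μ → 0 ℕ.< part μ i
  part-pos {x ∷ μ} (_ , p ∷ _) zero lt = p
  part-pos {x ∷ μ} P (suc i) (ℕ.s≤s lt) = part-pos (isPartition-tail P) i lt

  minSearch : ∀ (P : ℕ → Set) → (∀ i → Dec (P i)) → ∀ N →
    (Σ[ i ∈ ℕ ] (i ℕ.< N × P i × (∀ j → j ℕ.< i → ¬ P j))) ⊎ (∀ i → i ℕ.< N → ¬ P i)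
  minSearch P d zero = inj₂ (λ i ())
  minSearch P d (suc N) with minSearch P d N
  ... | inj₁ (i , lt , p , h) = inj₁ (i , ℕP.m≤n⇒m≤1+n lt , p , h)
  ... | inj₂ none with d N
  ...   | yes p = inj₁ (N , ℕP.≤-refl , p , none)
  ...   | no ¬p = inj₂ (λ i lt → [ (λ eq → subst (λ z → ¬ P z) (sym eq) ¬p) , none i ]′ (≤⇒≡⊎< (ℕP.≤-pred lt)))
    where ≤⇒≡⊎< : ∀ {i N} → i ℕ.≤ N → i ≡ N ⊎ i ℕ.< N
          ≤⇒≡⊎< {i} {N} le with ℕP.m≤n⇒m<n∨m≡n le
          ... | inj₁ lt = inj₂ lt
          ... | inj₂ eq = inj₁ eq

  maxSearch : ∀ (P : ℕ → Set) → (∀ i → Dec (P i)) → ∀ N →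
    (Σ[ i ∈ ℕ ] (i ℕ.< N × P i × (∀ j → i ℕ.< j → j ℕ.< N → ¬ P j))) ⊎ (∀ i → i ℕ.< N → ¬ P i)
  maxSearch P d zero = inj₂ (λ i ())
  maxSearch P d (suc N) with d N
  ... | yes p = inj₁ (N , ℕP.≤-refl , p , λ j lt lt′ → ⊥-elim (ℕP.<-irrefl refl (ℕP.<-≤-trans lt (ℕP.≤-pred lt′))))
  ... | no ¬p with maxSearch P d N
  ...   | inj₁ (i , lt , p , h) = inj₁ (i , ℕP.m≤n⇒m≤1+n lt , p , λ j lt1 lt2 → helper j lt1 lt2)
    where helper : ∀ j → i ℕ.< j → j ℕ.< suc N → ¬ P j
          helper j lt1 lt2 with ℕP.m≤n⇒m<n∨m≡n (ℕP.≤-pred lt2)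
          ... | inj₁ l = h j lt1 l
          ... | inj₂ refl = ¬p
  ...   | inj₂ none = inj₂ (λ i lt → helper i lt)
    where helper : ∀ i → i ℕ.< suc N → ¬ P i
          helper i lt with ℕP.m≤n⇒m<n∨m≡n (ℕP.≤-pred lt)
          ... | inj₁ l = none i l
          ... | inj₂ refl = ¬p

-- Let a and b be the first and last
-- rows of the hook.  The absence of 2×2 squares and connectivity force ν_i = λ_{i+1} - 1
-- for a ≤ i < b, so |λ| - |ν| = e says the bead λ_a - a minus e equals ν_b - b, which lies
-- strictly between consecutive beads of λ: closedness fails.
module RimHookBreaksClosure where

  open import Defs
  open IntegerFacts
  open MayaSets
  open RowSums
  open Beads
  open import Data.Nat as ℕ using (ℕ; suc)
  import Data.Nat.Properties as ℕP
  open import Data.Integer as ℤ using (ℤ; +_; _+_; _-_; -_; _≤_; _<_; 1ℤ)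
  import Data.Integer.Properties as ℤP
  open import Data.Integer.Tactic.RingSolver
  open import Data.List using (length)
  open import Data.Product
  open import Data.Sum
  open import Data.Empty
  open import Relation.Binary.PropositionalEquality
  open import Relation.Nullary
  open import Relation.Binary.Construct.Closure.ReflexiveTransitive using (Star; ε; _◅_)

  module Hook (e : ℕ) (e≥1 : 1 ℕ.≤ e) (λ′ : Partition) (Pλ : IsPartition λ′) (cl : Closed e λ′)
           (ν : Partition) (hook : IsRimHook e λ′ ν) where
    Pν = proj₁ hook
    cont : ∀ i → part ν i ℕ.≤ part λ′ i
    cont = proj₁ (proj₂ hook)
    sz : size λ′ ≡ size ν ℕ.+ e
    sz = proj₁ (proj₂ (proj₂ hook))
    conn = proj₁ (proj₂ (proj₂ (proj₂ hook)))
    no2 = proj₂ (proj₂ (proj₂ (proj₂ hook)))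
    p : ℕ → ℕ
    p = part λ′
    q : ℕ → ℕ
    q = part ν
    N : ℕ
    N = length λ′

    lenν : length ν ℕ.≤ N
    lenν with length ν ℕ.≤? N
    ... | yes le = le
    ... | no nle = ⊥-elim (ℕP.<-irrefl refl (ℕP.<-≤-trans (part-pos Pν N (ℕP.≰⇒> nle))
                     (subst (q N ℕ.≤_) (part-beyond λ′ N ℕP.≤-refl) (cont N))))

    eqBeyond : ∀ i → N ℕ.≤ i → q i ≡ p i
    eqBeyond i le = trans (part-beyond ν i (ℕP.≤-trans lenν le)) (sym (part-beyond λ′ i le))

    R : ℕ → Set
    R i = q i ℕ.< p i
    decR : ∀ i → Dec (R i)
    decR i = q i ℕP.<? p i

    notR⇒eq : ∀ i → ¬ R i → q i ≡ p i
    notR⇒eq i nr = ℕP.≤-antisym (cont i) (ℕP.≮⇒≥ nr)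

    allEq⇒⊥ : (∀ i → i ℕ.< N → ¬ R i) → ⊥
    allEq⇒⊥ none = ℕP.<-irrefl refl (ℕP.<-≤-trans (ℕP.m<m+n (size ν) (ℕP.<-≤-trans (ℕ.s≤s ℕ.z≤n) e≥1))
                     (ℕP.≤-reflexive (trans (sym sz) (ℤP.+-injective ssame))))
      where ssame : + size λ′ ≡ + size ν
            ssame = trans (sym (size≡ΣR λ′ N ℕP.≤-refl)) (trans (ΣR-cong _ _ 0 N (λ i → cong +_ (sym (eqi i)))) (size≡ΣR ν N lenν))
              where eqi : ∀ i → q i ≡ p i
                    eqi i with i ℕP.<? N
                    ... | yes lt = notR⇒eq i (none i lt)
                    ... | no nlt = eqBeyond i (ℕP.≮⇒≥ nlt)

    no2lemma : ∀ i → suc (suc (q i)) ℕ.≤ p (suc i) → ⊥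
    no2lemma i h = no2 (i , q i ,
       (ℕP.≤-refl , ℕP.<-≤-trans (ℕP.<-trans (ℕP.n<1+n _) h) (part-step Pλ i)) ,
       (part-step Pν i , ℕP.<-trans (ℕP.n<1+n _) h) ,
       (ℕP.n≤1+n _ , ℕP.<-≤-trans h (part-step Pλ i)) ,
       (ℕP.≤-trans (part-step Pν i) (ℕP.n≤1+n _) , h))

    connlemma : ∀ a b i → R a → R b → a ℕ.≤ i → i ℕ.< b → p (suc i) ℕ.≤ q i → ⊥
    connlemma a b i Ra Rb a≤i i<b h = ℕP.<-irrefl refl (ℕP.<-≤-trans i<b (inv path a≤i))
      where
      path = conn (a , q a) (b , q b) (ℕP.≤-refl , Ra) (ℕP.≤-refl , Rb)
      stepInv : ∀ {x y} → SkewStep λ′ ν x y → proj₁ x ℕ.≤ i → proj₁ y ℕ.≤ i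
      stepInv {r , j} {.(suc r) , .j} (s1 , s2 , inj₁ (refl , refl)) le with ℕP.m≤n⇒m<n∨m≡n le
      ... | inj₁ lt = lt
      ... | inj₂ refl = ⊥-elim (ℕP.<-irrefl refl (ℕP.<-≤-trans (proj₂ s2) (ℕP.≤-trans h (proj₁ s1))))
      stepInv {.(suc r′) , j} {r′ , j′} (s1 , s2 , inj₂ (inj₁ (refl , _))) le = ℕP.≤-trans (ℕP.n≤1+n r′) le
      stepInv {r , j} {r′ , j′} (s1 , s2 , inj₂ (inj₂ (inj₁ (refl , _)))) le = le
      stepInv {r , j} {r′ , j′} (s1 , s2 , inj₂ (inj₂ (inj₂ (refl , _)))) le = le
      inv : ∀ {x y} → Star (SkewStep λ′ ν) x y → proj₁ x ℕ.≤ i → proj₁ y ℕ.≤ i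
      inv ε le = le
      inv (st ◅ rest) le = inv rest (stepInv st le)

    r-m1 : ∀ q → q ≡ (1ℤ + q) - 1ℤ
    r-m1 = solve-∀

    -- ν_b - b is not a bead of λ when λ_{b+1} ≤ ν_b < λ_b: it lies strictly between the beads
    -- of rows b and b + 1.
    not-bead : ∀ b → q b ℕ.< p b → p (suc b) ℕ.≤ q b → ¬ Bead λ′ (+ q b - + b)
    not-bead b qb<pb pb1≤qb (k , eq) with k ℕP.≤? b
    ... | yes k≤b = ℤP.<-irrefl eq (ℤP.<-≤-trans lt1 lt2)
      where
      lt1 : + q b - + b < + p b - + b
      lt1 = ℤP.+-monoˡ-< (- + b) (ℤ.+<+ qb<pb)
      lt2 : + p b - + b ≤ + p k - + k
      lt2 = ℤP.+-mono-≤ (ℤ.+≤+ (part-antitone Pλ k≤b)) (ℤP.neg-mono-≤ (ℤ.+≤+ k≤b))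
    ... | no k≰b = ℤP.<-irrefl (sym eq) (ℤP.≤-<-trans lt2 lt1)
      where
      b<k : b ℕ.< k
      b<k = ℕP.≰⇒> k≰b
      lt2 : + p k - + k ≤ + p (suc b) - + suc b
      lt2 = ℤP.+-mono-≤ (ℤ.+≤+ (part-antitone Pλ b<k)) (ℤP.neg-mono-≤ (ℤ.+≤+ b<k))
      lt1 : + p (suc b) - + suc b < + q b - + b
      lt1 = ℤP.≤-<-trans (ℤP.+-monoˡ-≤ (- + suc b) (ℤ.+≤+ pb1≤qb))
              (ℤP.+-monoʳ-< (+ q b) (ℤP.neg-mono-< (ℤ.+<+ (ℕP.n<1+n b))))

    core : ∀ a b → a ℕ.< N → R a → (∀ j → j ℕ.< a → ¬ R j) → b ℕ.< N → R b → (∀ j → b ℕ.< j → j ℕ.< N → ¬ R j) → ⊥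
    core a b a<N Ra minA b<N Rb maxB with ℕP.m≤n⇒∃[o]m+o≡n a≤b
      where a≤b : a ℕ.≤ b
            a≤b with a ℕP.≤? b
            ... | yes le = le
            ... | no nle = ⊥-elim (minA b (ℕP.≰⇒> nle) Rb)
    ... | d , refl = not-bead b₀ Rb pb1 (subst (Bead λ′) xe (cl x (a , refl)))
      where
      eqBefore : ∀ i → i ℕ.< a → q i ≡ p i
      eqBefore i lt = notR⇒eq i (minA i lt)
      eqAfter : ∀ i → a ℕ.+ d ℕ.< i → q i ≡ p i
      eqAfter i lt with i ℕP.<? N
      ... | yes l = notR⇒eq i (maxB i lt l)
      ... | no nl = eqBeyond i (ℕP.≮⇒≥ nl)
      mid : ∀ i → a ℕ.≤ i → i ℕ.< a ℕ.+ d → + q i ≡ + p (suc i) - 1ℤ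
      mid i a≤i i<b = trans (r-m1 (+ q i)) (cong (λ z → z - 1ℤ) (cong +_ (sym peq)))
        where
        le1 : p (suc i) ℕ.≤ suc (q i)
        le1 = ℕP.≮⇒≥ (λ lt → no2lemma i lt)
        le2 : suc (q i) ℕ.≤ p (suc i)
        le2 = ℕP.≰⇒> (λ nle → connlemma a (a ℕ.+ d) i Ra Rb a≤i i<b nle)
        peq : p (suc i) ≡ suc (q i)
        peq = ℕP.≤-antisym le1 le2
      b₀ : ℕ
      b₀ = a ℕ.+ d
      x : ℤ
      x = + p a - + a
      sizeEq : + size λ′ - + size ν ≡ x - (+ q b₀ - + b₀)
      sizeEq = size-difference λ′ ν N a d ℕP.≤-refl lenν b<N eqBefore eqAfter mid
      eE : + e ≡ x - (+ q b₀ - + b₀)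
      eE = trans (l (+ size ν) (+ e)) (trans (cong (λ z → + z - + size ν) (sym (trans sz (ℕP.+-comm (size ν) e)))) sizeEq)
        where l : ∀ s e → e ≡ (e + s) - s
              l = solve-∀
      xe : x - + e ≡ + q b₀ - + b₀
      xe = trans (cong (λ z → x - z) eE) (l x (+ q b₀ - + b₀))
        where l : ∀ x y → x - (x - y) ≡ y
              l = solve-∀
      pb1 : p (suc b₀) ℕ.≤ q b₀
      pb1 = subst (ℕ._≤ q b₀) (eqAfter (suc b₀) ℕP.≤-refl) (part-step Pν b₀)

    absurd : ⊥
    absurd with minSearch R decR N | maxSearch R decR N
    ... | inj₂ none | _ = allEq⇒⊥ none
    ... | _ | inj₂ none = allEq⇒⊥ none
    ... | inj₁ (a , a<N , Ra , minA) | inj₁ (b , b<N , Rb , maxB) = core a b a<N Ra minA b<N Rb maxB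

  closed⇒core : ∀ e → 1 ℕ.≤ e → ∀ μ → IsPartition μ → Closed e μ → IsECore e μ
  closed⇒core e e≥1 μ P cl (ν , hook) = Hook.absurd e e≥1 μ P cl ν hook

-- If the bead x - e is missing below the bead x = λ_a - a, then λ has a removable rim
-- e-hook: with b ≥ a the last row whose bead lies above x - e, take ν_i = λ_{i+1} - 1 for
-- a ≤ i < b, ν_b = x - e + b, and ν_i = λ_i otherwise.
module GapGivesRimHook where

  open import Defs
  open IntegerFacts
  open MayaSets
  open PartitionOfSet
  open RowSums
  open Beads
  open import Data.Nat as ℕ using (ℕ; zero; suc; _∸_)
  import Data.Nat.Properties as ℕP
  open import Data.Integer as ℤ using (ℤ; +_; _+_; _-_; -_; _≤_; _<_; ∣_∣; 1ℤ)
  import Data.Integer.Properties as ℤP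
  open import Data.Integer.Tactic.RingSolver
  open import Data.List using (length)
  open import Data.Product
  open import Data.Sum
  open import Data.Empty
  open import Relation.Binary.PropositionalEquality
  open import Relation.Nullary
  open import Relation.Nullary.Decidable using (map′)
  open import Relation.Binary.Construct.Closure.ReflexiveTransitive using (Star; ε; _◅_; _◅◅_)
  import Relation.Binary.Construct.Closure.ReflexiveTransitive as RT

  r-bead : ∀ P I → (P - (1ℤ + I)) + 1ℤ ≡ P - I
  r-bead = solve-∀

  decBead : ∀ μ k → Dec (Bead μ k)
  decBead μ k = map′ (λ { (i , eq) → i , trans eq (r-bead (+ part μ i) (+ i)) })
                     (λ { (i , eq) → i , trans eq (sym (r-bead (+ part μ i) (+ i))) })
                     (L-dec 1ℤ μ k)

  adj-sym : ∀ {c d} → Adjacent c d → Adjacent d c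
  adj-sym (inj₁ (a , b)) = inj₂ (inj₁ (a , b))
  adj-sym (inj₂ (inj₁ (a , b))) = inj₁ (a , b)
  adj-sym (inj₂ (inj₂ (inj₁ (a , b)))) = inj₂ (inj₂ (inj₂ (a , b)))
  adj-sym (inj₂ (inj₂ (inj₂ (a , b)))) = inj₂ (inj₂ (inj₁ (a , b)))

  step-sym : ∀ {λ′ ν c d} → SkewStep λ′ ν c d → SkewStep λ′ ν d c
  step-sym (s1 , s2 , ad) = s2 , s1 , adj-sym ad

  pos-pred : ∀ m → 1 ℕ.≤ m → + (m ∸ 1) ≡ + m - 1ℤ
  pos-pred (suc m) _ = l (+ m)
    where l : ∀ m → m ≡ (1ℤ + m) - 1ℤ
          l = solve-∀

  module Gap (e′ : ℕ) (λ′ : Partition) (Pλ : IsPartition λ′) (a : ℕ) where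
    e : ℕ
    e = suc e′
    p : ℕ → ℕ
    p = part λ′
    v : ℕ → ℤ
    v i = + p i - + i
    x : ℤ
    x = v a
    y : ℤ
    y = x - + e
    N : ℕ
    N = length λ′

    v-drop : ∀ n i → v (i ℕ.+ n) ≤ v i - + n
    v-drop n i = subst (λ z → + p (i ℕ.+ n) - z ≤ v i - + n) (sym (ℤP.pos-+ i n))
      (subst (λ z → + p (i ℕ.+ n) - (+ i + + n) ≤ z) (l (+ p i) (+ i) (+ n))
        (ℤP.+-monoˡ-≤ (- (+ i + + n)) (ℤ.+≤+ (part-antitone Pλ (ℕP.m≤m+n i n)))))
      where l : ∀ P I M → P - (I + M) ≡ (P - I) - M
            l = solve-∀

    module _ (nb : ¬ Bead λ′ y) where
      Pt : ℕ → Set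
      Pt t = v (suc (a ℕ.+ t)) < y
      decPt : ∀ t → Dec (Pt t)
      decPt t = v (suc (a ℕ.+ t)) ℤP.<? y

      Pe : Pt e′
      Pe = ℤP.≤∧≢⇒< (subst (λ z → v z ≤ y) (ℕP.+-suc a e′) (v-drop e a))
                      (λ eq → nb (suc (a ℕ.+ e′) , sym eq))

      -- The least t < e with v (a + t + 1) < y; it exists because v (a + e) ≤ y and y is missing.
      found : Σ[ t ∈ ℕ ] (t ℕ.< e × Pt t × (∀ t′ → t′ ℕ.< t → ¬ Pt t′))
      found with minSearch Pt decPt e
      ... | inj₁ r = r
      ... | inj₂ none = ⊥-elim (none e′ ℕP.≤-refl Pe)

      t : ℕ
      t = proj₁ found
      t<e = proj₁ (proj₂ found)
      Ptt = proj₁ (proj₂ (proj₂ found))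
      mint = proj₂ (proj₂ (proj₂ found))
      b : ℕ
      b = a ℕ.+ t

      a≤b : a ℕ.≤ b
      a≤b = ℕP.m≤m+n a t

      y<vb : y < v b
      y<vb with t in eqt
      ... | zero = subst (λ z → y < v z) (sym (ℕP.+-identityʳ a)) (+suc⇒< e′ (l x (+ e′)))
        where l : ∀ x E → x ≡ (x - (1ℤ + E)) + (1ℤ + E)
              l = solve-∀
      ... | suc t′ = subst (λ z → y < v z) (sym (ℕP.+-suc a t′))
              (ℤP.≤∧≢⇒< (ℤP.≮⇒≥ (mint t′ (subst (t′ ℕ.<_) (sym eqt) ℕP.≤-refl)))
                        (λ eq → nb (suc (a ℕ.+ t′) , eq)))

      vb1<y : v (suc b) < y
      vb1<y = Ptt

      -- The new part in row b, chosen so that its bead is y.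
      qb : ℕ
      qb = ∣ y + + b ∣

      r-bead-succ : ∀ P B → (P - (1ℤ + B)) + 1ℤ ≡ P - B
      r-bead-succ = solve-∀
      r-unshift : ∀ P B → (P - B) + B ≡ P
      r-unshift = solve-∀

      pb1≤yb : + p (suc b) ≤ y + + b
      pb1≤yb = subst (_≤ y + + b) (r-unshift (+ p (suc b)) (+ b))
        (ℤP.+-monoˡ-≤ (+ b) (subst (_≤ y) (r-bead-succ (+ p (suc b)) (+ b)) (<-suc-≤ vb1<y)))

      qb-eq : + qb ≡ y + + b
      qb-eq = ℤP.0≤i⇒+∣i∣≡i (ℤP.≤-trans (ℤ.+≤+ ℕ.z≤n) pb1≤yb)

      pb1≤qb : p (suc b) ℕ.≤ qb
      pb1≤qb = ℤP.drop‿+≤+ (subst (+ p (suc b) ≤_) (sym qb-eq) pb1≤yb)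

      qb<pb : qb ℕ.< p b
      qb<pb = ℤP.drop‿+<+ (subst (_< + p b) (sym qb-eq) (subst (y + + b <_) (r-unshift (+ p b) (+ b)) (ℤP.+-monoˡ-< (+ b) y<vb)))

      b<N : b ℕ.< N
      b<N with b ℕP.<? N
      ... | yes lt = lt
      ... | no nlt = ⊥-elim (ℕP.<-irrefl refl (ℕP.<-≤-trans (ℕP.≤-<-trans ℕ.z≤n qb<pb) (ℕP.≤-reflexive (part-beyond λ′ b (ℕP.≮⇒≥ nlt)))))

      data Reg (i : ℕ) : Set where
        rB : i ℕ.< a → Reg i
        rM : a ℕ.≤ i → i ℕ.< b → Reg i
        rA : i ≡ b → Reg i
        rF : b ℕ.< i → Reg i

      reg : ∀ i → Reg i
      reg i with i ℕP.<? a
      ... | yes lt = rB lt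
      ... | no nlt with i ℕP.<? b
      ...   | yes lt = rM (ℕP.≮⇒≥ nlt) lt
      ...   | no nlt2 with i ℕP.≟ b
      ...     | yes eq = rA eq
      ...     | no neq = rF (ℕP.≤∧≢⇒< (ℕP.≮⇒≥ nlt2) (λ eq → neq (sym eq)))

      qv : ∀ i → Reg i → ℕ
      qv i (rB _) = p i
      qv i (rM _ _) = p (suc i) ∸ 1
      qv i (rA _) = qb
      qv i (rF _) = p i

      qf : ℕ → ℕ
      qf i = qv i (reg i)

      lt-irr : ∀ {m n} → m ℕ.< n → n ℕ.≤ m → ⊥
      lt-irr p q = ℕP.<-irrefl refl (ℕP.<-≤-trans p q)

      qf-B : ∀ i → i ℕ.< a → qf i ≡ p i
      qf-B i lt with reg i
      ... | rB _ = refl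
      ... | rM le _ = ⊥-elim (lt-irr lt le)
      ... | rA refl = ⊥-elim (lt-irr lt a≤b)
      ... | rF gt = ⊥-elim (lt-irr lt (ℕP.≤-trans a≤b (ℕP.<⇒≤ gt)))

      qf-M : ∀ i → a ℕ.≤ i → i ℕ.< b → qf i ≡ p (suc i) ∸ 1
      qf-M i le lt with reg i
      ... | rB lt′ = ⊥-elim (lt-irr lt′ le)
      ... | rM _ _ = refl
      ... | rA refl = ⊥-elim (ℕP.<-irrefl refl lt)
      ... | rF gt = ⊥-elim (ℕP.<-asym lt gt)

      qf-A : qf b ≡ qb
      qf-A with reg b
      ... | rB lt′ = ⊥-elim (lt-irr lt′ a≤b)
      ... | rM _ lt = ⊥-elim (ℕP.<-irrefl refl lt)
      ... | rA _ = refl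
      ... | rF gt = ⊥-elim (ℕP.<-irrefl refl gt)

      qf-F : ∀ i → b ℕ.< i → qf i ≡ p i
      qf-F i gt with reg i
      ... | rB lt′ = ⊥-elim (lt-irr lt′ (ℕP.≤-trans a≤b (ℕP.<⇒≤ gt)))
      ... | rM _ lt = ⊥-elim (ℕP.<-asym lt gt)
      ... | rA refl = ⊥-elim (ℕP.<-irrefl refl gt)
      ... | rF _ = refl

      pM≥1 : ∀ i → i ℕ.< b → 1 ℕ.≤ p (suc i)
      pM≥1 i lt = ℕP.≤-trans (ℕP.≤-<-trans ℕ.z≤n qb<pb) (part-antitone Pλ lt)

      cont : ∀ i → qf i ℕ.≤ p i
      cont i with reg i
      ... | rB _ = ℕP.≤-refl
      ... | rM _ _ = ℕP.≤-trans (ℕP.m∸n≤m _ 1) (part-step Pλ i)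
      ... | rA refl = ℕP.<⇒≤ qb<pb
      ... | rF _ = ℕP.≤-refl

      anti : Antitone qf
      anti i with reg i
      ... | rB lt = ℕP.≤-trans (cont (suc i)) (part-step Pλ i)
      ... | rM le lt with ℕP.m≤n⇒m<n∨m≡n lt
      ...   | inj₁ lt2 = subst (ℕ._≤ p (suc i) ∸ 1) (sym (qf-M (suc i) (ℕP.≤-trans le (ℕP.n≤1+n i)) lt2)) (ℕP.∸-monoˡ-≤ 1 (part-step Pλ (suc i)))
      ...   | inj₂ eq = subst₂ ℕ._≤_ (sym (trans (cong qf eq) qf-A)) (cong (λ z → p z ∸ 1) (sym eq)) (ℕP.∸-monoˡ-≤ 1 qb<pb)
      anti i | rA refl = subst (ℕ._≤ qb) (sym (qf-F (suc b) ℕP.≤-refl)) pb1≤qb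
      anti i | rF gt = subst (ℕ._≤ p i) (sym (qf-F (suc i) (ℕP.≤-trans gt (ℕP.n≤1+n i)))) (part-step Pλ i)

      vanish : ∀ i → N ℕ.≤ i → qf i ≡ 0
      vanish i le = trans (qf-F i (ℕP.<-≤-trans b<N le)) (part-beyond λ′ i le)

      ν : Partition
      ν = partitionOfParts qf N
      qν : ∀ i → part ν i ≡ qf i
      qν = partitionOfParts-part qf N anti vanish
      Pν : IsPartition ν
      Pν = partitionOfParts-isPartition qf N anti vanish

      sizeEq : size λ′ ≡ size ν ℕ.+ e
      sizeEq = ℤP.+-injective (trans (l (+ size λ′) (+ size ν)) (trans (cong (λ z → + size ν + z) (trans hk fin)) (sym (ℤP.pos-+ (size ν) e))))
        where
        l : ∀ A B → A ≡ B + (A - B)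
        l = solve-∀
        hk : + size λ′ - + size ν ≡ x - (+ part ν b - + b)
        hk = size-difference λ′ ν N a t ℕP.≤-refl (partitionOfParts-length qf N) b<N
               (λ i lt → trans (qν i) (qf-B i lt))
               (λ i gt → trans (qν i) (qf-F i gt))
               (λ i le lt → trans (cong +_ (trans (qν i) (qf-M i le lt))) (pos-pred _ (pM≥1 i lt)))
        fin : x - (+ part ν b - + b) ≡ + e
        fin = trans (cong (λ z → x - (+ z - + b)) (trans (qν b) qf-A))
              (trans (cong (λ z → x - (z - + b)) qb-eq) (l2 x (+ e) (+ b)))
          where l2 : ∀ x E B → x - ((x - E + B) - B) ≡ E
                l2 = solve-∀

      inSkew-q : ∀ {i j} → InSkew λ′ ν (i , j) → qf i ℕ.< p i
      inSkew-q {i} {j} (s1 , s2) = ℕP.≤-<-trans (subst (ℕ._≤ j) (qν i) s1) s2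

      region : ∀ {i j} → InSkew λ′ ν (i , j) → a ℕ.≤ i × i ℕ.≤ b
      region {i} s with reg i | inSkew-q s
      ... | rB lt | h = ⊥-elim (ℕP.<-irrefl refl h)
      ... | rM le lt | h = le , ℕP.<⇒≤ lt
      ... | rA refl | h = a≤b , ℕP.≤-refl
      ... | rF gt | h = ⊥-elim (ℕP.<-irrefl refl h)

      rim-step : ∀ i → a ℕ.≤ i → i ℕ.< b → p (suc i) ≡ suc (qf i)
      rim-step i a≤i i<b = trans (sym (ℕP.m∸n+n≡m (pM≥1 i i<b))) (trans (ℕP.+-comm _ 1) (cong suc (sym (qf-M i a≤i i<b))))

      no2 : ¬ (∃[ i ] ∃[ j ] (InSkew λ′ ν (i , j) × InSkew λ′ ν (suc i , j) ×
                       InSkew λ′ ν (i , suc j) × InSkew λ′ ν (suc i , suc j)))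
      no2 (i , j , s1 , s2 , s3 , s4) = lt-irr (proj₂ s4) (subst (ℕ._≤ suc j) (sym peq) (ℕ.s≤s h))
        where
        a≤i = proj₁ (region s1)
        i<b : i ℕ.< b
        i<b = proj₂ (region s2)
        h : qf i ℕ.≤ j
        h = subst (ℕ._≤ j) (qν i) (proj₁ s1)
        peq : p (suc i) ≡ suc (qf i)
        peq = rim-step i a≤i i<b

      Z : Cell
      Z = (b , qb)
      SS : Cell → Cell → Set
      SS = SkewStep λ′ ν

      -- Connectivity: every skew cell is joined to the cell (b, qb), first leftwards along its
      -- row and then down the rows.
      skewAt : ∀ i j → qf i ℕ.≤ j → j ℕ.< p i → InSkew λ′ ν (i , j)
      skewAt i j h1 h2 = subst (ℕ._≤ j) (sym (qν i)) h1 , h2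

      goLeft : ∀ i d → InSkew λ′ ν (i , qf i ℕ.+ d) → Star SS (i , qf i ℕ.+ d) (i , qf i)
      goLeft i zero s = subst (λ z → Star SS (i , z) (i , qf i)) (sym (ℕP.+-identityʳ (qf i))) ε
      goLeft i (suc d) s = (s , s′ , inj₂ (inj₂ (inj₂ (refl , ℕP.+-suc (qf i) d)))) ◅ goLeft i d s′
        where s′ : InSkew λ′ ν (i , qf i ℕ.+ d)
              s′ = skewAt i _ (ℕP.m≤m+n _ _) (ℕP.<-trans (subst (qf i ℕ.+ d ℕ.<_) (sym (ℕP.+-suc (qf i) d)) ℕP.≤-refl) (proj₂ s))

      toZrow : ∀ n i → b ≡ i ℕ.+ n → InSkew λ′ ν (i , qf i) → Star SS (i , qf i) Z
      toZrow zero i eq s rewrite ℕP.+-identityʳ i | sym eq | qf-A = ε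
      toZrow (suc n) i eq s = (s , sd , inj₁ (refl , refl)) ◅ (subst (λ z → Star SS (suc i , z) (suc i , qf (suc i))) dq (goLeft (suc i) d sd′) ◅◅ toZrow n (suc i) (trans eq (ℕP.+-suc i n)) s1)
        where
        i<b : i ℕ.< b
        i<b = subst (i ℕ.<_) (sym eq) (ℕP.m<m+n i (ℕ.s≤s ℕ.z≤n))
        a≤i = proj₁ (region s)
        peq : p (suc i) ≡ suc (qf i)
        peq = rim-step i a≤i i<b
        sd : InSkew λ′ ν (suc i , qf i)
        sd = skewAt (suc i) (qf i) (anti i) (subst (qf i ℕ.<_) (sym peq) ℕP.≤-refl)
        dd = ℕP.m≤n⇒∃[o]m+o≡n (anti i)
        d = proj₁ dd
        dq : qf (suc i) ℕ.+ d ≡ qf i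
        dq = proj₂ dd
        sd′ : InSkew λ′ ν (suc i , qf (suc i) ℕ.+ d)
        sd′ = subst (λ z → InSkew λ′ ν (suc i , z)) (sym dq) sd
        s1 : InSkew λ′ ν (suc i , qf (suc i))
        s1 = skewAt (suc i) _ ℕP.≤-refl (ℕP.≤-<-trans (anti i) (proj₂ sd))

      toZ : ∀ i j → InSkew λ′ ν (i , j) → Star SS (i , j) Z
      toZ i j s with ℕP.m≤n⇒∃[o]m+o≡n (subst (ℕ._≤ j) (qν i) (proj₁ s)) | ℕP.m≤n⇒∃[o]m+o≡n (proj₂ (region s))
      ... | d , refl | n , eqn = goLeft i d s ◅◅ toZrow n i (sym eqn) (skewAt i (qf i) ℕP.≤-refl (inSkew-q s))

      conn : ∀ c d → InSkew λ′ ν c → InSkew λ′ ν d → Star SS c d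
      conn (i , j) (i′ , j′) sc sd = toZ i j sc ◅◅ RT.reverse (step-sym {λ′} {ν}) (toZ i′ j′ sd)

      hook : IsRimHook e λ′ ν
      hook = Pν , (λ i → subst (ℕ._≤ p i) (sym (qν i)) (cont i)) , sizeEq , conn , no2

  core⇒closed : ∀ e′ μ → IsPartition μ → IsECore (suc e′) μ → Closed (suc e′) μ
  core⇒closed e′ μ P core k (a , refl) with decBead μ (+ part μ a - + a - + suc e′)
  ... | yes bd = bd
  ... | no nb = ⊥-elim (core (Gap.ν e′ μ P a nb , Gap.hook e′ μ P a nb))

-- The theorem for e = e″ + 2 and l = l′ + 1: the (e,s)-core condition and s ∈ Ā^l_e are
-- both expressed through the chain conditions on the components, which match the
-- e-closedness of the Uglov set.
module UglovBijection where

  open import Defs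
  open IntegerFacts
  open MayaSets
  open PartitionOfSet
  open Counting
  open UglovDecomposition
  open ChainConditions
  open SortingPermutation
  open Beads
  open RimHookBreaksClosure
  open GapGivesRimHook
  open import Data.Nat as ℕ using (ℕ; suc)
  import Data.Nat.Properties as ℕP
  open import Data.Integer as ℤ using (ℤ; +_; _+_; _-_; _*_; -_; _≤_; 1ℤ; _/ℕ_; _%ℕ_)
  import Data.Integer.Properties as ℤP
  import Data.Integer.DivMod as ℤD
  open import Data.Integer.Tactic.RingSolver
  open import Data.Fin as F using (Fin; toℕ)
  import Data.Fin.Properties as FP
  open import Data.Fin.Permutation using (Permutation′; _⟨$⟩ʳ_; _⟨$⟩ˡ_; inverseʳ)
  open import Data.Vec using (Vec; lookup; tabulate)
  import Data.Vec.Properties as VP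
  import Data.Vec.Relation.Unary.All.Properties as VAllP
  open import Data.Product
  open import Data.Empty
  open import Relation.Binary.PropositionalEquality
  open import Relation.Nullary

  vec-ext : ∀ {A : Set} {n} (u v : Vec A n) → (∀ i → lookup u i ≡ lookup v i) → u ≡ v
  vec-ext u v h = trans (sym (VP.tabulate∘lookup u)) (trans (VP.tabulate-cong h) (VP.tabulate∘lookup v))

  r-lb1 : ∀ P I t → (P - (1ℤ + I)) + t - (t - 1ℤ) ≡ P - I
  r-lb1 = solve-∀
  r-lb2 : ∀ P I t → P - I + (t - 1ℤ) ≡ (P - (1ℤ + I)) + t
  r-lb2 = solve-∀

  L⇒Bead : ∀ {t μ k} → LSet t μ k → Bead μ (k - (t - 1ℤ))
  L⇒Bead {t} {μ} (i , refl) = i , r-lb1 (+ part μ i) (+ i) t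

  Bead⇒L : ∀ {t μ k} → Bead μ k → LSet t μ (k + (t - 1ℤ))
  Bead⇒L {t} {μ} (i , refl) = i , r-lb2 (+ part μ i) (+ i) t

  r-c1 : ∀ k t E → (k + (t - 1ℤ)) - E - (t - 1ℤ) ≡ k - E
  r-c1 = solve-∀
  r-c2 : ∀ k t E → (k - (t - 1ℤ)) - E + (t - 1ℤ) ≡ k - E
  r-c2 = solve-∀

  LClosed : ℕ → ℤ → Partition → Set
  LClosed e t μ = ∀ k → LSet t μ k → LSet t μ (k - + e)

  LClosed⇒Closed : ∀ {e t μ} → LClosed e t μ → Closed e μ
  LClosed⇒Closed {e} {t} {μ} lc k b = subst (Bead μ) (r-c1 k t (+ e)) (L⇒Bead {t} {μ} (lc _ (Bead⇒L {t} {μ} b)))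

  Closed⇒LClosed : ∀ {e t μ} → Closed e μ → LClosed e t μ
  Closed⇒LClosed {e} {t} {μ} c k x = subst (LSet t μ) (r-c2 k t (+ e)) (Bead⇒L {t} {μ} (c _ (L⇒Bead {t} {μ} x)))

  LClosed⇔core : ∀ e′ {t μ} → IsPartition μ → (LClosed (suc e′) t μ → IsECore (suc e′) μ) × (IsECore (suc e′) μ → LClosed (suc e′) t μ)
  LClosed⇔core e′ {t} {μ} P = (λ lc → closed⇒core (suc e′) (ℕ.s≤s ℕ.z≤n) μ P (LClosed⇒Closed {suc e′} {t} {μ} lc))
                            , (λ core → Closed⇒LClosed {suc e′} {t} {μ} (core⇒closed e′ μ P core))

  -- Lexicographic order on (residue, index) encoded as residue · l + index.
  key-order : ∀ l (ra rb : ℕ) (ta tb : Fin l) → ra ℕ.* l ℕ.+ toℕ ta ℕ.< rb ℕ.* l ℕ.+ toℕ tb →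
              ra ℕ.≤ rb × (ra ≡ rb → toℕ ta ℕ.< toℕ tb)
  key-order l ra rb ta tb lt = le , eqc
    where
    le : ra ℕ.≤ rb
    le with ra ℕP.≤? rb
    ... | yes p = p
    ... | no np = ⊥-elim (ℕP.<-asym lt (ℕP.<-≤-trans (ℕP.+-monoʳ-< (rb ℕ.* l) (FP.toℕ<n tb))
            (ℕP.≤-trans (ℕP.≤-reflexive (ℕP.+-comm (rb ℕ.* l) l))
            (ℕP.≤-trans (ℕP.*-monoˡ-≤ l (ℕP.≰⇒> np)) (ℕP.m≤m+n (ra ℕ.* l) (toℕ ta))))))
    eqc : ra ≡ rb → toℕ ta ℕ.< toℕ tb
    eqc refl = ℕP.+-cancelˡ-< (ra ℕ.* l) (toℕ ta) (toℕ tb) lt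

  key-injective : ∀ l (ra rb : ℕ) (ta tb : Fin l) → ra ℕ.* l ℕ.+ toℕ ta ≡ rb ℕ.* l ℕ.+ toℕ tb → ta ≡ tb
  key-injective l ra rb ta tb eq = FP.toℕ-injective (proj₂ (divmod-unique l (+ ra) (+ rb) (toℕ ta) (toℕ tb)
    (FP.toℕ<n ta) (FP.toℕ<n tb) (trans (sym (pos-key ra (toℕ ta))) (trans (cong +_ eq) (pos-key rb (toℕ tb))))))
    where pos-key : ∀ r t → + (r ℕ.* l ℕ.+ t) ≡ + r * + l + + t
          pos-key r t = trans (ℤP.pos-+ (r ℕ.* l) t) (cong (_+ + t) (ℤP.pos-* r l))

  r-negq : ∀ s r q E → s ≡ r + q * E → r ≡ s + (- q) * E
  r-negq s r q E refl = lq r q E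
    where lq : ∀ r q E → r ≡ (r + q * E) + (- q) * E
          lq = solve-∀

  module Proof (e″ l′ : ℕ) where
    e′ : ℕ
    e′ = suc e″
    e : ℕ
    e = suc e′
    l : ℕ
    l = suc l′
    open Runners e′ l′ using (U; X; X⇒U; U⇒X)
    open RunnerBounds e′ l′ using (module UglovWindow; module Components)
    open RunnerShift e′ l′ using (chain⇒U-closed; U-closed⇒step; U-closed⇒wrap)
    open DivModE e using (qq; rr; rr<e; kdec)
    open Chains e l′ hiding (l)

    res : ℤ → ℕ
    res k = k %ℕ e

    res-dec : ∀ k → k ≡ + res k + (k /ℕ e) * + e
    res-dec k = ℤD.a≡a%ℕn+[a/ℕn]*n k e

    module _ (s : Vec ℤ l) (λs : Vec Partition l) (Ps : ∀ i → IsPartition (lookup λs i)) where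
      cX : Fin l → ℤ
      cX = lookup s
      νX : Fin l → Partition
      νX = lookup λs

      module SortedFamily (σ : Permutation′ l) where
        cY : Fin l → ℤ
        cY i = + residue e (lookup s (σ ⟨$⟩ʳ i))
        νY : Fin l → Partition
        νY i = lookup λs (σ ⟨$⟩ʳ i)

        lookup-cY : ∀ i → lookup (tabulate cY) i ≡ cY i
        lookup-cY = VP.lookup∘tabulate cY
        lookup-νY : ∀ i → lookup (tabulate νY) i ≡ νY i
        lookup-νY = VP.lookup∘tabulate νY

        reduced⇒chain : IsReducedCore e (tabulate cY) (tabulate νY) → Ch1 cY νY × Ch2 cY νY
        reduced⇒chain (red1 , red2) =
            (λ i i′ eq k x → subst₂ (λ a b → LSet a b k) (lookup-cY i′) (lookup-νY i′)
               (red1 i i′ eq k (subst₂ (λ a b → LSet a b k) (sym (lookup-cY i)) (sym (lookup-νY i)) x)))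
          , (λ i i′ eq eq′ k x → subst₂ (λ a b → LSet (a + + e) b k) (lookup-cY i′) (lookup-νY i′)
               (red2 i i′ eq eq′ k (subst₂ (λ a b → LSet a b k) (sym (lookup-cY i)) (sym (lookup-νY i)) x)))

        chain⇒reduced : Ch1 cY νY → Ch2 cY νY → IsReducedCore e (tabulate cY) (tabulate νY)
        chain⇒reduced ch1 ch2 =
            (λ i i′ eq k x → subst₂ (λ a b → LSet a b k) (sym (lookup-cY i′)) (sym (lookup-νY i′))
               (ch1 i i′ eq k (subst₂ (λ a b → LSet a b k) (lookup-cY i) (lookup-νY i) x)))
          , (λ i i′ eq eq′ k x → subst₂ (λ a b → LSet (a + + e) b k) (sym (lookup-cY i′)) (sym (lookup-νY i′))
               (ch2 i i′ eq eq′ k (subst₂ (λ a b → LSet a b k) (lookup-cY i) (lookup-νY i) x)))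

      -- An (e,s)-core satisfies the total chain: the sorted family does, and the two
      -- families differ by a permutation and charge shifts by multiples of e.
      core⇒total : IsCore e s λs → TotalChain cX νX
      core⇒total (σ , _ , red) = total-transfer cY νY cX νX (σ ⟨$⟩ˡ_) (λ j → lookup s j /ℕ e) hc hν
          (chain⇒total cY νY (λ i → Ps (σ ⟨$⟩ʳ i)) (proj₁ (reduced⇒chain red)) (proj₂ (reduced⇒chain red)))
        where
        open SortedFamily σ
        hc : ∀ j → cX j ≡ cY (σ ⟨$⟩ˡ j) + (lookup s j /ℕ e) * + e
        hc j = trans (res-dec (lookup s j)) (cong (λ z → + residue e (lookup s z) + (lookup s j /ℕ e) * + e) (sym (inverseʳ σ)))
        hν : ∀ j → νX j ≡ νY (σ ⟨$⟩ˡ j)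
        hν j = cong (lookup λs) (sym (inverseʳ σ))

      -- Conversely, the total chain makes (s, λs) an (e,s)-core, with σ obtained by sorting
      -- the indices by (residue, index).
      total⇒core : TotalChain cX νX → IsCore e s λs
      total⇒core tt = σ , sigma , chain⇒reduced ch1Y ch2Y
        where
        key : Fin l → ℕ
        key j = res (lookup s j) ℕ.* l ℕ.+ toℕ j
        sorted = sortBy l key (λ a b → key-injective l (res (lookup s a)) (res (lookup s b)) a b)
        σ = proj₁ sorted
        open SortedFamily σ
        sigma : IsSigma e s σ
        sigma i j eq = key-order l _ _ (σ ⟨$⟩ʳ i) (σ ⟨$⟩ʳ j) (proj₂ sorted i j eq)
        ttY : TotalChain cY νY
        ttY = total-transfer cX νX cY νY (σ ⟨$⟩ʳ_) (λ i → - (lookup s (σ ⟨$⟩ʳ i) /ℕ e))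
                (λ i → r-negq (lookup s (σ ⟨$⟩ʳ i)) (+ res (lookup s (σ ⟨$⟩ʳ i))) (lookup s (σ ⟨$⟩ʳ i) /ℕ e) (+ e)
                                (res-dec (lookup s (σ ⟨$⟩ʳ i))))
                (λ i → refl) tt
        ch1Y : Ch1 cY νY
        ch1Y = total⇒step cY νY ttY (λ i i′ eq → ℤ.+≤+ (proj₁ (sigma i i′ eq)))
        ch2Y : Ch2 cY νY
        ch2Y = total⇒wrap cY νY ttY (λ i i′ _ _ →
                 ℤP.≤-trans (ℤ.+≤+ (ℕP.<⇒≤ (ℤD.n%ℕd<d (lookup s (σ ⟨$⟩ʳ i)) e))) (ℤP.i≤j+i (+ e) (cY i′)))

      abar∧total⇒chain : InAbar e s → TotalChain cX νX → Ch1 cX νX × Ch2 cX νX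
      abar∧total⇒chain ab tt = total⇒step cX νX tt (λ i i′ eq → proj₁ (ab i i′ (subst (toℕ i ℕ.<_) (sym eq) ℕP.≤-refl)))
                             , total⇒wrap cX νX tt last≤first+e
        where
        last≤first+e : ∀ (i i′ : Fin l) → suc (toℕ i) ≡ l → toℕ i′ ≡ 0 → cX i ≤ cX i′ + + e
        last≤first+e i i′ eq eq′ with toℕ i ℕ.≟ 0
        ... | yes z with FP.toℕ-injective (trans z (sym eq′))
        ...   | refl = ℤP.i≤i+j (cX i) (+ e)
        last≤first+e i i′ eq eq′ | no nz = proj₂ (ab i′ i (subst (ℕ._< toℕ i) (sym eq′) (ℕP.n≢0⇒n>0 nz)))

      -- and the cyclic chain forces s ∈ Ā^l_e by charge monotonicity.
      chain⇒abar : Ch1 cX νX → Ch2 cX νX → InAbar e s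
      chain⇒abar c1 c2 i j lt = ⊆⇒charge≤ (Ps i) (Ps j) (chain-mono cX νX Ps c1 i j (ℕP.<⇒≤ lt))
                              , ⊆⇒charge≤ (Ps j) (Ps i) (chain-round cX νX Ps c1 c2 j i)

      chain⇒closed : Ch1 cX νX → Ch2 cX νX → ∀ m → U s λs m → U s λs (m - + e)
      chain⇒closed c1 c2 = chain⇒U-closed s λs c1
        (λ i i′ eq eq′ k x → L-shift⇒ {lookup s i′} {lookup λs i′} (+ e) (c2 i i′ (cong suc eq) eq′ k x))

      closed⇒chain : (∀ m → U s λs m → U s λs (m - + e)) → Ch1 cX νX × Ch2 cX νX
      closed⇒chain uc = U-closed⇒step s λs uc
        , (λ i i′ eq eq′ k x → L-shift⇐ {lookup s i′} {lookup λs i′} (+ e) (U-closed⇒wrap s λs uc i i′ (ℕP.suc-injective eq) eq′ k x))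

    -- Well-definedness: U is a Maya set, closed under k ↦ k - e, so its partition is an e-core.
    well-defined : (s : Vec ℤ l) (λs : Vec Partition l) → InDomain e s λs → ∃[ μ ] (IsUglov e s λs μ × IsECore e μ)
    well-defined s λs (ab , allP , core) =
      μ , (isP , t , λ k → proj₁ same k , proj₂ same k) , proj₁ (LClosed⇔core e′ isP) Lclosed
      where
      Ps : ∀ i → IsPartition (lookup λs i)
      Ps = VAllP.lookup⁺ allP
      chain = abar∧total⇒chain s λs Ps ab (core⇒total s λs Ps core)
      open Associated (UglovWindow.associatedU s λs Ps)
      Lclosed : LClosed e t μ
      Lclosed k x = proj₂ same _ (chain⇒closed s λs Ps (proj₁ chain) (proj₂ chain) k (proj₁ same k x))

    -- Injectivity: equal sums give equal charges (uglov-charge), hence equal Uglov sets,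
    -- equal components, and equal (s_i, λ^i) by maya-injective.
    injective : (s s′ : Vec ℤ l) (λs λs′ : Vec Partition l) (μ : Partition) →
        InDomain e s λs → InDomain e s′ λs′ →
        IsUglov e s λs μ → IsUglov e s′ λs′ μ → sumℤ s ≡ sumℤ s′ → (s ≡ s′ × λs ≡ λs′)
    injective s s′ λs λs′ μ (_ , allP , _) (_ , allP′ , _) (Pμ , t , h) (_ , t′ , h′) sums≡ =
      vec-ext s s′ (λ i → proj₁ (component≡ i)) , vec-ext λs λs′ (λ i → proj₂ (component≡ i))
      where
      Ps = VAllP.lookup⁺ allP
      Ps′ = VAllP.lookup⁺ allP′
      L≡U : SameSet (LSet t μ) (U s λs)
      L≡U = (λ k → proj₁ (h k)) , (λ k → proj₂ (h k))
      L≡U′ : SameSet (LSet t′ μ) (U s′ λs′)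
      L≡U′ = (λ k → proj₁ (h′ k)) , (λ k → proj₂ (h′ k))
      t≡t′ : t ≡ t′
      t≡t′ = trans (Runners.uglov-charge e′ l′ s λs t μ Ps Pμ L≡U)
                   (trans sums≡ (sym (Runners.uglov-charge e′ l′ s′ λs′ t′ μ Ps′ Pμ L≡U′)))
      U≡U′ : SameSet (U s λs) (U s′ λs′)
      U≡U′ = (λ k u → proj₁ L≡U′ k (subst (λ z → LSet z μ k) t≡t′ (proj₂ L≡U k u)))
           , (λ k u → proj₁ L≡U k (subst (λ z → LSet z μ k) (sym t≡t′) (proj₂ L≡U′ k u)))
      transfer : ∀ s s′ λs λs′ → U s λs ⊆ℤ U s′ λs′ → ∀ i → X s λs i ⊆ℤ X s′ λs′ i
      transfer s s′ λs λs′ inc i k x = subst (X s′ λs′ i) (sym (kdec k))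
        (U⇒X s′ λs′ i (qq k) (rr k) (rr<e k) (inc _ (X⇒U s λs i (qq k) (rr k) (rr<e k) (subst (X s λs i) (kdec k) x))))
      component≡ : ∀ i → lookup s i ≡ lookup s′ i × lookup λs i ≡ lookup λs′ i
      component≡ i = maya-injective (lookup s i) (lookup s′ i) (lookup λs i) (lookup λs′ i) (Ps i) (Ps′ i)
                       (transfer s s′ λs λs′ (proj₁ U≡U′) i , transfer s′ s λs′ λs (proj₂ U≡U′) i)

    -- Surjectivity: split L_n(μ) into its l components; these Maya sets have charges summing
    -- to n, and the e-closedness of L_n(μ) gives the cyclic chain, hence s ∈ Ā^l_e and the
    -- (e,s)-core condition.
    surjective : (μ : Partition) (n : ℤ) → IsPartition μ → IsECore e μ →
        Σ[ s ∈ Vec ℤ l ] Σ[ λs ∈ Vec Partition l ] (InDomain e s λs × IsUglov e s λs μ × sumℤ s ≡ n)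
    surjective μ n Pμ core =
      s , λs , (chain⇒abar s λs Ps c1 c2 , VAllP.tabulate⁺ (λ i → Associated.isP (associatedComponent i)) , isCore)
        , (Pμ , n , λ k → proj₂ U≡L k , proj₁ U≡L k) , sym sum≡n
      where
      open Components n μ Pμ
      s = tabulate (λ i → Associated.t (associatedComponent i))
      λs = tabulate (λ i → Associated.μ (associatedComponent i))
      lookup-s = VP.lookup∘tabulate (λ i → Associated.t (associatedComponent i))
      lookup-λs = VP.lookup∘tabulate (λ i → Associated.μ (associatedComponent i))
      Ps : ∀ i → IsPartition (lookup λs i)
      Ps i = subst IsPartition (sym (lookup-λs i)) (Associated.isP (associatedComponent i))
      X≡component : ∀ i → SameSet (X s λs i) (component i)
      X≡component i = (λ k x → proj₁ (Associated.same (associatedComponent i)) k (subst₂ (λ a b → LSet a b k) (lookup-s i) (lookup-λs i) x))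
                    , (λ k x → subst₂ (λ a b → LSet a b k) (sym (lookup-s i)) (sym (lookup-λs i)) (proj₂ (Associated.same (associatedComponent i)) k x))
      U≡L : SameSet (U s λs) (LSet n μ)
      U≡L = U-of-components s λs X≡component
      sum≡n : n ≡ sumℤ s
      sum≡n = Runners.uglov-charge e′ l′ s λs n μ Ps Pμ (SameSet-sym U≡L)
      Lclosed : LClosed e n μ
      Lclosed = proj₂ (LClosed⇔core e′ Pμ) core
      chain = closed⇒chain s λs Ps (λ m u → proj₂ U≡L _ (Lclosed m (proj₁ U≡L m u)))
      c1 = proj₁ chain
      c2 = proj₂ chain
      isCore : IsCore e s λs
      isCore = total⇒core s λs Ps (chain⇒total (lookup s) (lookup λs) Ps c1 c2)

open import Defs
open import Data.Nat using (ℕ; _≤_; zero; suc; s≤s)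
open import Data.Integer using (ℤ)
open import Data.Vec using (Vec)
open import Data.Product using (_×_; _,_; ∃-syntax; Σ-syntax)
open import Relation.Binary.PropositionalEquality using (_≡_)

mainTheorem3 : (e l : ℕ) → 2 ≤ e → 1 ≤ l →
    ((s : Vec ℤ l) (λs : Vec Partition l) → InDomain e s λs →
    ∃[ μ ] (IsUglov e s λs μ × IsECore e μ)) ×
    ((s s′ : Vec ℤ l) (λs λs′ : Vec Partition l) (μ : Partition) →
    InDomain e s λs → InDomain e s′ λs′ →
    IsUglov e s λs μ → IsUglov e s′ λs′ μ → sumℤ s ≡ sumℤ s′ →
    (s ≡ s′ × λs ≡ λs′)) ×
    ((μ : Partition) (n : ℤ) → IsPartition μ → IsECore e μ →
    Σ[ s ∈ Vec ℤ l ] Σ[ λs ∈ Vec Partition l ] (InDomain e s λs × IsUglov e s λs μ × sumℤ s ≡ n))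
mainTheorem3 (suc (suc e″)) (suc l′) _ _ = well-defined , injective , surjective
  where open UglovBijection.Proof e″ l′
mainTheorem3 zero          _       ()            _
mainTheorem3 (suc zero)    _       (s≤s ())      _
mainTheorem3 (suc (suc _)) zero    _             ()
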